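{- For every even integer $k \ge 0$, there exists a graph $G$ such that $\mathrm{lcr}^\circ(G) = k$ and $\mathrm{sn}(G) = k+2$.
   Context: A convex drawing of a finite simple graph $G$ places the vertices at distinct points of a circle and draws every edge as a straight-line segment; it is outer $k$-planar if every edge crosses at most $k$ other edges. The convex local crossing number $\mathrm{lcr}^\circ(G)$ is the smallest $k$ such that $G$ admits an outer $k$-planar drawing. A pair $(A,B)$ of vertex sets of a graph $H$ with $n$ vertices is a separation if $A\cup B=V(H)$ and there is no edge between $A\setminus B$ and $B\setminus A$; it is balanced if $|A\setminus B|\le 2n/3$ and $|B\setminus A|\le 2n/3$; its order is $|A\cap B|$. The separation number $\mathrm{sn}(G)$ is the minimum integer $s$ such that every subgraph of $G$ has a balanced separation of order at most $s$. -}

module Defs where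

open import Data.Nat using (ℕ; zero; suc; _+_; _*_; _≤_; _<_; _<ᵇ_; _≡ᵇ_)
open import Data.Bool using (Bool; true; false; _∧_; _∨_; not; _xor_; if_then_else_)
open import Data.Fin using (Fin; toℕ)
import Data.Fin as F
open import Data.Product using (Σ; _×_; _,_; proj₁)
open import Relation.Binary.PropositionalEquality using (_≡_)
open import Relation.Nullary using (¬_)
open import Function.Definitions using (Injective)

record Graph : Set where
  field
    n      : ℕ
    adj    : Fin n → Fin n → Bool
    sym    : ∀ u v → adj u v ≡ adj v u
    irrefl : ∀ v → adj v v ≡ false
open Graph public

count : {m : ℕ} → (Fin m → Bool) → ℕ
count {zero}  p = 0
count {suc m} p = (if p F.zero then 1 else 0) + count (λ i → p (F.suc i))

countPairs : {m : ℕ} → (Fin m → Fin m → Bool) → ℕ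
countPairs {m} p = count2 (λ x y → (toℕ x <ᵇ toℕ y) ∧ p x y)
  where
  sumFin : {k : ℕ} → (Fin k → ℕ) → ℕ
  sumFin {zero}  f = 0
  sumFin {suc k} f = f F.zero + sumFin (λ i → f (F.suc i))
  count2 : (Fin m → Fin m → Bool) → ℕ
  count2 q = sumFin (λ x → count (λ y → q x y))

-- A convex drawing is determined (up to crossing
-- structure) by the circular order of the vertices, given here by an
-- injective position map  pos : Fin n → Fin n  (positions around the circle).

betweenᵇ : ℕ → ℕ → ℕ → Bool
betweenᵇ a b c = ((a <ᵇ c) ∧ (c <ᵇ b)) ∨ ((b <ᵇ c) ∧ (c <ᵇ a))

-- straight-line chords with endpoints at positions a,b and c,d cross
-- iff the four endpoints are distinct and interleave around the circle
crossᵇ : ℕ → ℕ → ℕ → ℕ → Bool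
crossᵇ a b c d =
  not (a ≡ᵇ c) ∧ not (a ≡ᵇ d) ∧ not (b ≡ᵇ c) ∧ not (b ≡ᵇ d)
  ∧ (betweenᵇ a b c xor betweenᵇ a b d)

crossings : (G : Graph) → (Fin (n G) → Fin (n G)) → Fin (n G) → Fin (n G) → ℕ
crossings G pos u v =
  countPairs (λ x y → adj G x y ∧
    crossᵇ (toℕ (pos u)) (toℕ (pos v)) (toℕ (pos x)) (toℕ (pos y)))

ConvexDrawing : Graph → Set
ConvexDrawing G = Σ (Fin (n G) → Fin (n G)) λ pos → Injective _≡_ _≡_ pos

OuterKPlanar : (G : Graph) → ConvexDrawing G → ℕ → Set
OuterKPlanar G (pos , _) k =
  ∀ u v → adj G u v ≡ true → crossings G pos u v ≤ k

IsLeast : (ℕ → Set) → ℕ → Set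
IsLeast P k = P k × (∀ j → j < k → ¬ P j)

ConvexLocalCrossingNumber : Graph → ℕ → Set
ConvexLocalCrossingNumber G =
  IsLeast (λ k → Σ (ConvexDrawing G) λ D → OuterKPlanar G D k)

record Subgraph (G : Graph) : Set where
  field
    S      : Fin (n G) → Bool
    E      : Fin (n G) → Fin (n G) → Bool
    E-sym  : ∀ u v → E u v ≡ E v u
    E-adj  : ∀ u v → E u v ≡ true → adj G u v ≡ true
    E-S    : ∀ u v → E u v ≡ true → S u ≡ true
open Subgraph public

BalancedSeparation : {G : Graph} → Subgraph G →
                     (Fin (n G) → Bool) → (Fin (n G) → Bool) → ℕ → Set
BalancedSeparation H A B s =
  (∀ v → (A v ∨ B v) ≡ S H v)
  × (∀ u v → (A u ∧ not (B u)) ≡ true → (B v ∧ not (A v)) ≡ true → E H u v ≡ false)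
  × (3 * count (λ v → A v ∧ not (B v)) ≤ 2 * count (S H))
  × (3 * count (λ v → B v ∧ not (A v)) ≤ 2 * count (S H))
  × (count (λ v → A v ∧ B v) ≤ s)

AllSubgraphsSeparable : Graph → ℕ → Set
AllSubgraphsSeparable G s =
  (H : Subgraph G) → Σ (Fin (n G) → Bool) λ A → Σ (Fin (n G) → Bool) λ B →
    BalancedSeparation H A B s

SeparationNumber : Graph → ℕ → Set
SeparationNumber G = IsLeast (AllSubgraphsSeparable G)

-- The graph is the cylinder C_m □ P_d with d = k/2 + 1 rows and m columns, m large.  Drawn with
-- its vertices column by column around the circle, vertical edges join neighbouring points and a
-- horizontal edge has d - 1 points on one side, each incident to at most two crossing (horizontal)
-- edges, so lcr° ≤ 2d - 2 = k.  Two columns form a balanced separator, so sn ≤ 2d = k + 2.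
--
-- Conversely, fewer than 2d vertices leave some row with at most one of them, and every set of at
-- least T = 2d² vertices meets a column free of them; along such columns and around that row any
-- two such sets are joined.  This gives sn ≥ 2d.  It also bounds convex drawings: for a chord of the
-- circle, its end points together with the inner ends of the edges crossing it separate the two
-- sides, so a chord with enough vertices on both sides is crossed by at least 2d - 2 edges.  Such a
-- chord exists in every drawing: either some edge is long on both sides, or all edges are short and
-- we take the chord between two points covered by few edges, found near the end points of a
-- longest edge covering a given point.

module Submission where

open import Defs hiding (sym)
open import Data.Bool using (Bool; true; false; _∧_; _∨_; not; _xor_; if_then_else_)
open import Data.Bool.Properties
  using (∧-comm; ∨-comm; ∧-zeroʳ; ∨-zeroʳ; ∧-conicalˡ; ∧-conicalʳ; ∨-conicalˡ; ∨-conicalʳ;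
         not-injective; not-¬; ¬-not; xor-same; xor-comm; xor-annihilates-not)
  renaming (_≟_ to _≟ᴮ_)
open import Data.Empty using (⊥; ⊥-elim)
open import Data.Fin using (Fin; toℕ; fromℕ<; _↑ˡ_; _↑ʳ_; combine; remQuot)
import Data.Fin as F
import Data.Fin.Properties as FP
open import Data.Nat using (ℕ; zero; suc; _+_; _*_; _∸_; _≤_; _<_; z≤n; s≤s; _<ᵇ_; _≡ᵇ_; _<?_; _≟_)
open import Data.Nat.Divisibility using (_∣_; divides)
open import Data.Nat.Properties
open import Algebra.Properties.CommutativeMonoid.Sum +-0-commutativeMonoid
  using (sum; ∑-distrib-+; ∑-comm; sum-cong-≗)
open import Data.Nat.Solver using (module +-*-Solver)
open import Data.Product using (Σ; ∃; _×_; _,_; proj₁; proj₂)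
open import Data.Sum using (_⊎_; inj₁; inj₂; [_,_])
open import Function using (_∘_; id)
open import Function.Definitions using (Injective)
open import Relation.Binary.Definitions using (Tri; tri<; tri≈; tri>)
open import Relation.Binary.PropositionalEquality hiding ([_])
open import Relation.Nullary using (¬_; Dec; yes; no; does)
open import Relation.Nullary.Decidable using (dec-true; dec-false)

open +-*-Solver using (solve; _:+_; _:*_; _:=_; con)

does≡true⇒ : ∀ {A : Set} (a? : Dec A) → does a? ≡ true → A
does≡true⇒ (yes a) _ = a

does≡false⇒¬ : ∀ {A : Set} (a? : Dec A) → does a? ≡ false → ¬ A
does≡false⇒¬ (no ¬a) _ = ¬a

<ᵇ≡true⇒< : ∀ m n → (m <ᵇ n) ≡ true → m < n
<ᵇ≡true⇒< m n = does≡true⇒ (m <? n)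

<⇒<ᵇ≡true : ∀ {m n} → m < n → (m <ᵇ n) ≡ true
<⇒<ᵇ≡true {m} {n} = dec-true (m <? n)

<ᵇ≡false⇒≥ : ∀ m n → (m <ᵇ n) ≡ false → n ≤ m
<ᵇ≡false⇒≥ m n e = ≮⇒≥ (does≡false⇒¬ (m <? n) e)

≥⇒<ᵇ≡false : ∀ {m n} → n ≤ m → (m <ᵇ n) ≡ false
≥⇒<ᵇ≡false {m} {n} n≤m = dec-false (m <? n) (≤⇒≯ n≤m)

≡ᵇ≡true⇒≡ : ∀ m n → (m ≡ᵇ n) ≡ true → m ≡ n
≡ᵇ≡true⇒≡ m n = does≡true⇒ (m ≟ n)

≡⇒≡ᵇ≡true : ∀ {m n} → m ≡ n → (m ≡ᵇ n) ≡ true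
≡⇒≡ᵇ≡true {m} {n} = dec-true (m ≟ n)

≡ᵇ≡false⇒≢ : ∀ m n → (m ≡ᵇ n) ≡ false → ¬ m ≡ n
≡ᵇ≡false⇒≢ m n = does≡false⇒¬ (m ≟ n)

≢⇒≡ᵇ≡false : ∀ m n → ¬ m ≡ n → (m ≡ᵇ n) ≡ false
≢⇒≡ᵇ≡false m n = dec-false (m ≟ n)

≡ᵇ-comm : ∀ m n → (m ≡ᵇ n) ≡ (n ≡ᵇ m)
≡ᵇ-comm zero    zero    = refl
≡ᵇ-comm zero    (suc n) = refl
≡ᵇ-comm (suc m) zero    = refl
≡ᵇ-comm (suc m) (suc n) = ≡ᵇ-comm m n

∨≡true⇒⊎ : ∀ {a b} → a ∨ b ≡ true → a ≡ true ⊎ b ≡ true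
∨≡true⇒⊎ {true}  _ = inj₁ refl
∨≡true⇒⊎ {false} e = inj₂ e

∨≡trueʳ : ∀ a {b} → b ≡ true → a ∨ b ≡ true
∨≡trueʳ a refl = ∨-zeroʳ a

𝟙 : Bool → ℕ
𝟙 b = if b then 1 else 0

sum-mono-≤ : ∀ {n} {f g : Fin n → ℕ} → (∀ i → f i ≤ g i) → sum f ≤ sum g
sum-mono-≤ {zero}  h = z≤n
sum-mono-≤ {suc n} h = +-mono-≤ (h F.zero) (sum-mono-≤ (h ∘ F.suc))

sum-*ˡ : ∀ {n} c (f : Fin n → ℕ) → sum (λ i → c * f i) ≡ c * sum f
sum-*ˡ {zero}  c f = sym (*-zeroʳ c)
sum-*ˡ {suc n} c f =
  trans (cong (c * f F.zero +_) (sum-*ˡ c (f ∘ F.suc))) (sym (*-distribˡ-+ c _ _))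

sum-zero : ∀ {n} {f : Fin n → ℕ} → (∀ i → f i ≡ 0) → sum f ≡ 0
sum-zero {zero}  h = refl
sum-zero {suc n} h rewrite h F.zero = sum-zero (h ∘ F.suc)

sum-const : ∀ n c → sum {n} (λ _ → c) ≡ n * c
sum-const zero    c = refl
sum-const (suc n) c = cong (c +_) (sum-const n c)

count≡∑𝟙 : ∀ {n} (p : Fin n → Bool) → count p ≡ sum (𝟙 ∘ p)
count≡∑𝟙 {zero}  p = refl
count≡∑𝟙 {suc n} p = cong (𝟙 (p F.zero) +_) (count≡∑𝟙 (p ∘ F.suc))

count-cong : ∀ {n} {p q : Fin n → Bool} → (∀ i → p i ≡ q i) → count p ≡ count q
count-cong {zero}  h = refl
count-cong {suc n} h = cong₂ _+_ (cong 𝟙 (h F.zero)) (count-cong (h ∘ F.suc))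

𝟙-mono : ∀ {a b} → (a ≡ true → b ≡ true) → 𝟙 a ≤ 𝟙 b
𝟙-mono {false} h = z≤n
𝟙-mono {true}  h rewrite h refl = ≤-refl

count-mono : ∀ {n} {p q : Fin n → Bool} → (∀ i → p i ≡ true → q i ≡ true) → count p ≤ count q
count-mono {zero}  h = z≤n
count-mono {suc n} h = +-mono-≤ (𝟙-mono (h F.zero)) (count-mono (h ∘ F.suc))

count≤n : ∀ {n} (p : Fin n → Bool) → count p ≤ n
count≤n {zero}  p = z≤n
count≤n {suc n} p = +-mono-≤ (𝟙-mono {b = true} (λ _ → refl)) (count≤n (p ∘ F.suc))

count-all-true : ∀ {n} {p : Fin n → Bool} → (∀ i → p i ≡ true) → count p ≡ n
count-all-true {zero}  h = refl
count-all-true {suc n} h rewrite h F.zero = cong suc (count-all-true (h ∘ F.suc))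

count-all-false : ∀ {n} {p : Fin n → Bool} → (∀ i → p i ≡ false) → count p ≡ 0
count-all-false {zero}  h = refl
count-all-false {suc n} h rewrite h F.zero = count-all-false (h ∘ F.suc)

count-≥1 : ∀ {n} {p : Fin n → Bool} i → p i ≡ true → 1 ≤ count p
count-≥1 {p = p} F.zero    e rewrite e = s≤s z≤n
count-≥1 {p = p} (F.suc i) e = ≤-trans (count-≥1 i e) (m≤n+m _ (𝟙 (p F.zero)))

count≡0⇒false : ∀ {n} {p : Fin n → Bool} → count p ≡ 0 → ∀ i → p i ≡ false
count≡0⇒false {p = p} h i with p i in pi
... | false = refl
... | true  with () ← subst (1 ≤_) h (count-≥1 i pi)

count>0⇒∃ : ∀ {n} (p : Fin n → Bool) → 0 < count p → ∃ λ i → p i ≡ true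
count>0⇒∃ {suc n} p h with p F.zero in e
... | true  = F.zero , e
... | false = let (i , pi) = count>0⇒∃ (p ∘ F.suc) h in F.suc i , pi

count-+ : ∀ {n} {p q r : Fin n → Bool} → (∀ i → 𝟙 (r i) ≡ 𝟙 (p i) + 𝟙 (q i)) →
          count r ≡ count p + count q
count-+ {p = p} {q} {r} h = begin
  count r                              ≡⟨ count≡∑𝟙 r ⟩
  sum (𝟙 ∘ r)                          ≡⟨ sum-cong-≗ h ⟩
  sum (λ i → 𝟙 (p i) + 𝟙 (q i))        ≡⟨ ∑-distrib-+ (𝟙 ∘ p) (𝟙 ∘ q) ⟩
  sum (𝟙 ∘ p) + sum (𝟙 ∘ q)            ≡⟨ sym (cong₂ _+_ (count≡∑𝟙 p) (count≡∑𝟙 q)) ⟩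
  count p + count q                    ∎
  where open ≡-Reasoning

count-split : ∀ {n} (p q : Fin n → Bool) →
              count p ≡ count (λ i → p i ∧ q i) + count (λ i → p i ∧ not (q i))
count-split p q = count-+ (λ i → split (p i) (q i))
  where
  split : ∀ a b → 𝟙 a ≡ 𝟙 (a ∧ b) + 𝟙 (a ∧ not b)
  split false b     = refl
  split true  false = refl
  split true  true  = refl

count-∨-disjoint : ∀ {n} (p q : Fin n → Bool) → (∀ i → p i ≡ true → q i ≡ true → ⊥) →
                   count (λ i → p i ∨ q i) ≡ count p + count q
count-∨-disjoint p q h = count-+ (λ i → 𝟙-∨ (p i) (q i) (h i))
  where
  𝟙-∨ : ∀ a b → (a ≡ true → b ≡ true → ⊥) → 𝟙 (a ∨ b) ≡ 𝟙 a + 𝟙 b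
  𝟙-∨ false b     _ = refl
  𝟙-∨ true  false _ = refl
  𝟙-∨ true  true  h = ⊥-elim (h refl refl)

count-∨ : ∀ {n} (p q : Fin n → Bool) → count (λ i → p i ∨ q i) ≤ count p + count q
count-∨ p q = begin
  count (λ i → p i ∨ q i)
    ≤⟨ count-mono pick ⟩
  count (λ i → p i ∨ (not (p i) ∧ q i))
    ≡⟨ count-∨-disjoint p (λ i → not (p i) ∧ q i) disjoint ⟩
  count p + count (λ i → not (p i) ∧ q i)
    ≤⟨ +-monoʳ-≤ (count p) (count-mono {q = q} (λ i → ∧-conicalʳ (not (p i)) (q i))) ⟩
  count p + count q ∎
  where
  open ≤-Reasoning
  pick : ∀ i → p i ∨ q i ≡ true → p i ∨ (not (p i) ∧ q i) ≡ true
  pick i e with p i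
  ... | true  = refl
  ... | false = e
  disjoint : ∀ i → p i ≡ true → not (p i) ∧ q i ≡ true → ⊥
  disjoint i e e′ rewrite e = not-¬ e′ refl

count-≤1 : ∀ {n} (p : Fin n → Bool) → (∀ i j → p i ≡ true → p j ≡ true → i ≡ j) → count p ≤ 1
count-≤1 {zero}  p h = z≤n
count-≤1 {suc n} p h with p F.zero in e
... | false = count-≤1 (p ∘ F.suc) (λ i j pi pj → FP.suc-injective (h (F.suc i) (F.suc j) pi pj))
... | true  = ≤-reflexive (cong suc (count-all-false (λ i → ¬-not (λ pi → 0≢suc (h F.zero (F.suc i) e pi)))))
  where
  0≢suc : ∀ {i} → ¬ F.zero ≡ F.suc {n} i
  0≢suc ()

count-remove : ∀ {n} (p : Fin n → Bool) c → p c ≡ true →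
               count p ≡ suc (count (λ i → p i ∧ not (does (i FP.≟ c))))
count-remove p c e =
  trans (count-split p (λ i → does (i FP.≟ c))) (cong (_+ count (λ i → p i ∧ not (does (i FP.≟ c)))) single)
  where
  is-c : ∀ {i} → p i ∧ does (i FP.≟ c) ≡ true → i ≡ c
  is-c {i} = does≡true⇒ (i FP.≟ c) ∘ ∧-conicalʳ _ _
  single : count (λ i → p i ∧ does (i FP.≟ c)) ≡ 1
  single = ≤-antisym (count-≤1 _ (λ i j pi pj → trans (is-c pi) (sym (is-c pj))))
                     (count-≥1 c (cong₂ _∧_ e (dec-true (c FP.≟ c) refl)))

count-≤1⇒unique : ∀ {n} {p : Fin n → Bool} → count p ≤ 1 →
                  ∀ {i j} → p i ≡ true → p j ≡ true → i ≡ j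
count-≤1⇒unique {p = p} h {i} {j} pi pj with j FP.≟ i
... | yes j≡i = sym j≡i
... | no  j≢i = ⊥-elim (≤⇒≯ (subst (_≤ 1) (count-remove p i pi) h)
                            (s≤s (count-≥1 j (cong₂ _∧_ pj (cong not (dec-false (j FP.≟ i) j≢i))))))

count-injective : ∀ {a b} {P : Fin a → Bool} {Q : Fin b → Bool} (f : Fin a → Fin b) →
                  (∀ {x y} → P x ≡ true → P y ≡ true → f x ≡ f y → x ≡ y) →
                  (∀ {x} → P x ≡ true → Q (f x) ≡ true) → count P ≤ count Q
count-injective {zero}  f inj maps = z≤n
count-injective {suc a} {P = P} {Q} f inj maps with P F.zero in e
... | false = count-injective (f ∘ F.suc) (λ px py → FP.suc-injective ∘ inj px py) maps
... | true rewrite count-remove Q (f F.zero) (maps e) =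
  s≤s (count-injective (f ∘ F.suc) (λ px py → FP.suc-injective ∘ inj px py)
         (λ {x} px → cong₂ _∧_ (maps px) (cong not (dec-false (f (F.suc x) FP.≟ f F.zero)
                                                      (λ fx≡f0 → 0≢suc (inj e px (sym fx≡f0)))))))
  where
  0≢suc : ∀ {i} → ¬ F.zero ≡ F.suc {a} i
  0≢suc ()

search : ∀ {n} (p : Fin n → Bool) → (∃ λ i → p i ≡ true) ⊎ (∀ i → p i ≡ false)
search p with FP.any? (λ i → p i ≟ᴮ true)
... | yes w  = inj₁ w
... | no  ¬w = inj₂ (λ i → ¬-not (λ pi → ¬w (i , pi)))

argmax : ∀ {n} (p : Fin n → Bool) (f : Fin n → ℕ) → (∃ λ i → p i ≡ true) →
         ∃ λ i → p i ≡ true × (∀ j → p j ≡ true → f j ≤ f i)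
argmax {suc n} p f (i₀ , pi₀) with search (p ∘ F.suc)
... | inj₂ none = F.zero , zero-true i₀ pi₀ , zero-max
  where
  zero-true : ∀ i → p i ≡ true → p F.zero ≡ true
  zero-true F.zero    e = e
  zero-true (F.suc i) e = ⊥-elim (not-¬ e (none i))
  zero-max : ∀ j → p j ≡ true → f j ≤ f F.zero
  zero-max F.zero    _ = ≤-refl
  zero-max (F.suc j) e = ⊥-elim (not-¬ e (none j))
... | inj₁ w with argmax (p ∘ F.suc) (f ∘ F.suc) w
...   | b , pb , b-max with f F.zero ≤? f (F.suc b)
...     | yes f0≤ = F.suc b , pb , λ { F.zero _ → f0≤ ; (F.suc j) pj → b-max j pj }
...     | no  f0≰ with p F.zero in e0
...       | true  = F.zero , e0 , λ { F.zero _ → ≤-refl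
                                    ; (F.suc j) pj → ≤-trans (b-max j pj) (≰⇒≥ f0≰) }
...       | false = F.suc b , pb , λ { F.zero pj → ⊥-elim (not-¬ pj e0) ; (F.suc j) pj → b-max j pj }

module _ {n : ℕ} where

  private
    pair : Fin (n * n) → Fin n × Fin n
    pair = remQuot n

    pair-combine : ∀ x y → pair (combine x y) ≡ (x , y)
    pair-combine = FP.remQuot-combine

  search₂ : (p : Fin n → Fin n → Bool) → (∃ λ x → ∃ λ y → p x y ≡ true) ⊎ (∀ x y → p x y ≡ false)
  search₂ p with search (λ k → p (proj₁ (pair k)) (proj₂ (pair k)))
  ... | inj₁ (k , e) = inj₁ (proj₁ (pair k) , proj₂ (pair k) , e)
  ... | inj₂ none    = inj₂ (λ x y → subst (λ (x , y) → p x y ≡ false) (pair-combine x y) (none (combine x y)))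

  argmax₂ : (p : Fin n → Fin n → Bool) (f : Fin n → Fin n → ℕ) → (∃ λ x → ∃ λ y → p x y ≡ true) →
            ∃ λ x → ∃ λ y → p x y ≡ true × (∀ x′ y′ → p x′ y′ ≡ true → f x′ y′ ≤ f x y)
  argmax₂ p f (x₀ , y₀ , e₀) with argmax (λ k → p (proj₁ (pair k)) (proj₂ (pair k)))
                                         (λ k → f (proj₁ (pair k)) (proj₂ (pair k)))
                                         (combine x₀ y₀ , at-pair (sym (pair-combine x₀ y₀)) e₀)
    where
    at-pair : ∀ {x y k} → (x , y) ≡ pair k → p x y ≡ true → p (proj₁ (pair k)) (proj₂ (pair k)) ≡ true
    at-pair eq e = subst (λ (x , y) → p x y ≡ true) eq e
  ... | k , pk , max = proj₁ (pair k) , proj₂ (pair k) , pk , λ x′ y′ e′ →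
    subst (λ (x , y) → f x y ≤ f (proj₁ (pair k)) (proj₂ (pair k))) (pair-combine x′ y′)
          (max (combine x′ y′) (subst (λ (x , y) → p x y ≡ true) (sym (pair-combine x′ y′)) e′))

count-< : ∀ {n} c → c ≤ n → count {n} (λ i → toℕ i <ᵇ c) ≡ c
count-< {zero}  zero    _       = refl
count-< {suc n} zero    _       = count-all-false {n} (λ _ → refl)
count-< {suc n} (suc c) (s≤s h) = cong suc (count-< c h)

not-<ᵇ-suc : ∀ a c → not (a <ᵇ suc c) ≡ (c <ᵇ a)
not-<ᵇ-suc zero    c       = refl
not-<ᵇ-suc (suc a) zero    = refl
not-<ᵇ-suc (suc a) (suc c) = not-<ᵇ-suc a c

count-> : ∀ {n} c → c < n → count {n} (λ i → c <ᵇ toℕ i) + suc c ≡ n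
count-> {n} c c<n = begin
  count {n} (λ i → c <ᵇ toℕ i) + suc c  ≡⟨ cong₂ _+_ (count-cong {n} (λ i → sym (not-<ᵇ-suc (toℕ i) c)))
                                                 (sym (count-< (suc c) c<n)) ⟩
  count {n} (not ∘ q) + count q         ≡⟨ +-comm (count (not ∘ q)) (count q) ⟩
  count q + count {n} (not ∘ q)         ≡⟨ sym (count-split (λ _ → true) q) ⟩
  count {n} (λ _ → true)            ≡⟨ count-all-true (λ _ → refl) ⟩
  n                                 ∎
  where
  open ≡-Reasoning
  q : Fin n → Bool
  q i = toℕ i <ᵇ suc c

count-between : ∀ {n} a b → a < b → b ≤ n →
                count {n} (λ i → (a <ᵇ toℕ i) ∧ (toℕ i <ᵇ b)) + suc a ≡ b
count-between {n} a b a<b b≤n = begin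
  count {n} (λ i → (a <ᵇ toℕ i) ∧ (toℕ i <ᵇ b)) + suc a
    ≡⟨ cong₂ _+_ (count-cong {n} (λ i → ∧-comm (a <ᵇ toℕ i) (toℕ i <ᵇ b)))
                 (trans (sym (count-< {n} (suc a) (≤-trans a<b b≤n))) (count-cong {n} (below ∘ toℕ))) ⟩
  count {n} (λ i → (toℕ i <ᵇ b) ∧ (a <ᵇ toℕ i)) + count {n} (λ i → (toℕ i <ᵇ b) ∧ not (a <ᵇ toℕ i))
    ≡⟨ sym (count-split {n} (λ i → toℕ i <ᵇ b) (λ i → a <ᵇ toℕ i)) ⟩
  count {n} (λ i → toℕ i <ᵇ b)
    ≡⟨ count-< {n} b b≤n ⟩
  b ∎
  where
  open ≡-Reasoning
  below : ∀ x → (x <ᵇ suc a) ≡ ((x <ᵇ b) ∧ not (a <ᵇ x))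
  below x with x ≤? a
  ... | yes x≤a rewrite <⇒<ᵇ≡true (s≤s x≤a) | <⇒<ᵇ≡true (≤-<-trans x≤a a<b) | ≥⇒<ᵇ≡false x≤a
    = refl
  ... | no  x≰a rewrite ≥⇒<ᵇ≡false {x} {suc a} (≰⇒> x≰a) | <⇒<ᵇ≡true (≰⇒> x≰a)
    = sym (∧-zeroʳ _)

count-↑ : ∀ {a b} (q : Fin (a + b) → Bool) → count q ≡ count (q ∘ (_↑ˡ b)) + count (q ∘ (a ↑ʳ_))
count-↑ {zero}      q = refl
count-↑ {suc a} {b} q =
  trans (cong (𝟙 (q F.zero) +_) (count-↑ {a} (q ∘ F.suc))) (sym (+-assoc (𝟙 (q F.zero)) _ _))

count-combine : ∀ {m d} (q : Fin (m * d) → Bool) →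
                count q ≡ sum {m} (λ b → count {d} (λ o → q (combine b o)))
count-combine {zero}      q = refl
count-combine {suc m} {d} q =
  trans (count-↑ {d} q) (cong (count (q ∘ (_↑ˡ m * d)) +_) (count-combine {m} (q ∘ (d ↑ʳ_))))

-- A point missed by f would let punchOut compress f into an injection Fin (1 + n) → Fin n.
injective⇒surjective : ∀ {n} {f : Fin n → Fin n} → Injective _≡_ _≡_ f → ∀ y → ∃ λ x → f x ≡ y
injective⇒surjective {suc n} {f} inj y with FP.any? (λ x → f x FP.≟ y)
... | yes hit  = hit
... | no  miss = ⊥-elim (1+n≰n (FP.injective⇒≤ {f = squeeze} squeeze-injective))
  where
  y≢f : ∀ x → ¬ y ≡ f x
  y≢f x y≡fx = miss (x , sym y≡fx)
  squeeze : Fin (suc n) → Fin n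
  squeeze x = F.punchOut (y≢f x)
  squeeze-injective : Injective _≡_ _≡_ squeeze
  squeeze-injective {x} {x′} = inj ∘ FP.punchOut-injective (y≢f x) (y≢f x′)

count-preimage : ∀ {n} {f : Fin n → Fin n} → Injective _≡_ _≡_ f →
                 (q : Fin n → Bool) → count q ≤ count (q ∘ f)
count-preimage {f = f} inj q =
  count-injective f⁻¹ (λ _ _ e → trans (sym (f∘f⁻¹ _)) (trans (cong f e) (f∘f⁻¹ _)))
                      (λ {y} qy → subst (λ z → q z ≡ true) (sym (f∘f⁻¹ y)) qy)
  where
  f⁻¹ : Fin _ → Fin _
  f⁻¹ y = proj₁ (injective⇒surjective inj y)
  f∘f⁻¹ : ∀ y → f (f⁻¹ y) ≡ y
  f∘f⁻¹ y = proj₂ (injective⇒surjective inj y)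

∑∑ : ∀ {n} → (Fin n → Fin n → ℕ) → ℕ
∑∑ f = sum (λ x → sum (f x))

∑∑-cong : ∀ {n} {f g : Fin n → Fin n → ℕ} → (∀ x y → f x y ≡ g x y) → ∑∑ f ≡ ∑∑ g
∑∑-cong h = sum-cong-≗ (λ x → sum-cong-≗ (h x))

∑∑-mono-≤ : ∀ {n} {f g : Fin n → Fin n → ℕ} → (∀ x y → f x y ≤ g x y) → ∑∑ f ≤ ∑∑ g
∑∑-mono-≤ h = sum-mono-≤ (λ x → sum-mono-≤ (h x))

∑∑-distrib-+ : ∀ {n} (f g : Fin n → Fin n → ℕ) → ∑∑ (λ x y → f x y + g x y) ≡ ∑∑ f + ∑∑ g
∑∑-distrib-+ f g =
  trans (sum-cong-≗ (λ x → ∑-distrib-+ (f x) (g x))) (∑-distrib-+ (λ x → sum (f x)) (λ x → sum (g x)))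

_<ᶠ_ : ∀ {n} → Fin n → Fin n → Bool
x <ᶠ y = toℕ x <ᵇ toℕ y

<ᶠ-asym : ∀ {n} (x y : Fin n) → x <ᶠ y ≡ true → y <ᶠ x ≡ true → ⊥
<ᶠ-asym x y x<y y<x = <-asym (<ᵇ≡true⇒< (toℕ x) (toℕ y) x<y) (<ᵇ≡true⇒< (toℕ y) (toℕ x) y<x)

<ᶠ-total : ∀ {n} (x y : Fin n) → ¬ x ≡ y → (x <ᶠ y) ∨ (y <ᶠ x) ≡ true
<ᶠ-total x y x≢y with <-cmp (toℕ x) (toℕ y)
... | tri< x<y _ _ = cong (_∨ (y <ᶠ x)) (<⇒<ᵇ≡true x<y)
... | tri≈ _ x≡y _ = ⊥-elim (x≢y (FP.toℕ-injective x≡y))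
... | tri> _ _ y<x = ∨≡trueʳ (x <ᶠ y) (<⇒<ᵇ≡true y<x)

countPairs≡∑∑ : ∀ {n} (p : Fin n → Fin n → Bool) →
                countPairs p ≡ ∑∑ (λ x y → 𝟙 ((x <ᶠ y) ∧ p x y))
countPairs≡∑∑ {zero}  p = refl
countPairs≡∑∑ {suc n} p =
  cong₂ _+_ (count≡∑𝟙 (λ y → (F.zero <ᶠ y) ∧ p F.zero y))
            (countPairs≡∑∑ (λ x y → p (F.suc x) (F.suc y)))

countPairs-mono : ∀ {n} {p q : Fin n → Fin n → Bool} → (∀ x y → p x y ≡ true → q x y ≡ true) →
                  countPairs p ≤ countPairs q
countPairs-mono {p = p} {q} h = begin
  countPairs p                              ≡⟨ countPairs≡∑∑ p ⟩
  ∑∑ (λ x y → 𝟙 ((x <ᶠ y) ∧ p x y))         ≤⟨ ∑∑-mono-≤ (λ x y → 𝟙-mono (∧-mono x y)) ⟩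
  ∑∑ (λ x y → 𝟙 ((x <ᶠ y) ∧ q x y))         ≡⟨ countPairs≡∑∑ q ⟨
  countPairs q                              ∎
  where
  open ≤-Reasoning
  ∧-mono : ∀ x y → (x <ᶠ y) ∧ p x y ≡ true → (x <ᶠ y) ∧ q x y ≡ true
  ∧-mono x y e = cong₂ _∧_ (∧-conicalˡ _ _ e) (h x y (∧-conicalʳ (x <ᶠ y) _ e))

countPairs-cong : ∀ {n} {p q : Fin n → Fin n → Bool} → (∀ x y → p x y ≡ q x y) →
                  countPairs p ≡ countPairs q
countPairs-cong h = ≤-antisym (countPairs-mono (λ x y e → trans (sym (h x y)) e))
                              (countPairs-mono (λ x y e → trans (h x y) e))

countPairs-none : ∀ {n} {p : Fin n → Fin n → Bool} → (∀ x y → p x y ≡ false) → countPairs p ≡ 0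
countPairs-none {p = p} h = trans (countPairs≡∑∑ p) (sum-zero (λ x → sum-zero (λ y →
  cong 𝟙 (trans (cong ((x <ᶠ y) ∧_) (h x y)) (∧-zeroʳ (x <ᶠ y))))))

countPairs-disjoint : ∀ {n} {p q r : Fin n → Fin n → Bool} →
                      (∀ x y → p x y ≡ true → q x y ≡ true → ⊥) →
                      (∀ x y → p x y ≡ true → r x y ≡ true) → (∀ x y → q x y ≡ true → r x y ≡ true) →
                      countPairs p + countPairs q ≤ countPairs r
countPairs-disjoint {p = p} {q} {r} disj p⊆r q⊆r = begin
  countPairs p + countPairs q
    ≡⟨ cong₂ _+_ (countPairs≡∑∑ p) (countPairs≡∑∑ q) ⟩
  ∑∑ (λ x y → 𝟙 ((x <ᶠ y) ∧ p x y)) + ∑∑ (λ x y → 𝟙 ((x <ᶠ y) ∧ q x y))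
    ≡⟨ ∑∑-distrib-+ (λ x y → 𝟙 ((x <ᶠ y) ∧ p x y)) (λ x y → 𝟙 ((x <ᶠ y) ∧ q x y)) ⟨
  ∑∑ (λ x y → 𝟙 ((x <ᶠ y) ∧ p x y) + 𝟙 ((x <ᶠ y) ∧ q x y))
    ≤⟨ ∑∑-mono-≤ (λ x y → pointwise (x <ᶠ y) (p x y) (q x y) (r x y) (disj x y) (p⊆r x y) (q⊆r x y)) ⟩
  ∑∑ (λ x y → 𝟙 ((x <ᶠ y) ∧ r x y))
    ≡⟨ countPairs≡∑∑ r ⟨
  countPairs r ∎
  where
  open ≤-Reasoning
  pointwise : ∀ o a b c → (a ≡ true → b ≡ true → ⊥) →
              (a ≡ true → c ≡ true) → (b ≡ true → c ≡ true) →
              𝟙 (o ∧ a) + 𝟙 (o ∧ b) ≤ 𝟙 (o ∧ c)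
  pointwise false a     b     c _ _   _   = z≤n
  pointwise true  true  true  c d _   _   = ⊥-elim (d refl refl)
  pointwise true  true  false c _ a⊆c _   rewrite a⊆c refl = ≤-refl
  pointwise true  false true  c _ _   b⊆c rewrite b⊆c refl = ≤-refl
  pointwise true  false false c _ _   _   = z≤n

countPairs-∨ : ∀ {n} {p q r : Fin n → Fin n → Bool} → (∀ x y → r x y ≡ true → p x y ∨ q x y ≡ true) →
               countPairs r ≤ countPairs p + countPairs q
countPairs-∨ {p = p} {q} {r} r⊆p∨q = begin
  countPairs r
    ≡⟨ countPairs≡∑∑ r ⟩
  ∑∑ (λ x y → 𝟙 ((x <ᶠ y) ∧ r x y))
    ≤⟨ ∑∑-mono-≤ (λ x y → pointwise (x <ᶠ y) (p x y) (q x y) (r x y) (r⊆p∨q x y)) ⟩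
  ∑∑ (λ x y → 𝟙 ((x <ᶠ y) ∧ p x y) + 𝟙 ((x <ᶠ y) ∧ q x y))
    ≡⟨ ∑∑-distrib-+ (λ x y → 𝟙 ((x <ᶠ y) ∧ p x y)) (λ x y → 𝟙 ((x <ᶠ y) ∧ q x y)) ⟩
  ∑∑ (λ x y → 𝟙 ((x <ᶠ y) ∧ p x y)) + ∑∑ (λ x y → 𝟙 ((x <ᶠ y) ∧ q x y))
    ≡⟨ cong₂ _+_ (countPairs≡∑∑ p) (countPairs≡∑∑ q) ⟨
  countPairs p + countPairs q ∎
  where
  open ≤-Reasoning
  pointwise : ∀ o a b c → (c ≡ true → a ∨ b ≡ true) → 𝟙 (o ∧ c) ≤ 𝟙 (o ∧ a) + 𝟙 (o ∧ b)
  pointwise false a     b c _ = z≤n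
  pointwise true  true  b c _ = ≤-trans (𝟙-mono {b = true} (λ _ → refl)) (m≤m+n 1 (𝟙 b))
  pointwise true  false b false _ = z≤n
  pointwise true  false b true  h rewrite h refl = ≤-refl

countPairs-across : ∀ {n} (S : Fin n → Bool) (p : Fin n → Fin n → Bool) → (∀ x y → p x y ≡ p y x) →
                    (∀ x y → p x y ≡ true → S x xor S y ≡ true) →
                    countPairs p ≡ sum (λ x → count (λ y → S x ∧ p x y))
countPairs-across {n} S p p-sym across = begin
  countPairs p                         ≡⟨ countPairs≡∑∑ p ⟩
  ∑∑ (λ x y → 𝟙 ((x <ᶠ y) ∧ p x y))    ≡⟨ ∑∑-cong split-by-side ⟩
  ∑∑ (λ x y → A x y + C x y)           ≡⟨ ∑∑-distrib-+ A C ⟩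
  ∑∑ A + ∑∑ C                          ≡⟨ cong (∑∑ A +_) C≡B ⟩
  ∑∑ A + ∑∑ B                          ≡⟨ ∑∑-distrib-+ A B ⟨
  ∑∑ (λ x y → A x y + B x y)           ≡⟨ ∑∑-cong split-by-order ⟨
  ∑∑ (λ x y → 𝟙 (S x ∧ p x y))         ≡⟨ sum-cong-≗ (λ x → count≡∑𝟙 (λ y → S x ∧ p x y)) ⟨
  sum (λ x → count (λ y → S x ∧ p x y)) ∎
  where
  open ≡-Reasoning
  A B C : Fin n → Fin n → ℕ
  A x y = 𝟙 ((x <ᶠ y) ∧ (S x ∧ p x y))
  B x y = 𝟙 ((y <ᶠ x) ∧ (S x ∧ p x y))
  C x y = 𝟙 ((x <ᶠ y) ∧ (S y ∧ p x y))

  C≡B : ∑∑ C ≡ ∑∑ B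
  C≡B = trans (∑∑-cong (λ x y → cong (λ z → 𝟙 ((x <ᶠ y) ∧ (S y ∧ z))) (p-sym x y))) (sym (∑-comm B))

  split-xor : ∀ o s t q → (q ≡ true → s xor t ≡ true) →
              𝟙 (o ∧ q) ≡ 𝟙 (o ∧ (s ∧ q)) + 𝟙 (o ∧ (t ∧ q))
  split-xor false s     t     q     _ = refl
  split-xor true  s     t     false _ rewrite ∧-zeroʳ s | ∧-zeroʳ t = refl
  split-xor true  false true  true  _ = refl
  split-xor true  true  false true  _ = refl
  split-xor true  false false true  h = ⊥-elim (not-¬ (h refl) refl)
  split-xor true  true  true  true  h = ⊥-elim (not-¬ (h refl) refl)

  split-order : ∀ a b s q → (a ≡ true → b ≡ true → ⊥) → (q ≡ true → a ∨ b ≡ true) →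
                𝟙 (s ∧ q) ≡ 𝟙 (a ∧ (s ∧ q)) + 𝟙 (b ∧ (s ∧ q))
  split-order a     b     false q     _ _ rewrite ∧-zeroʳ a | ∧-zeroʳ b = refl
  split-order a     b     true  false _ _ rewrite ∧-zeroʳ a | ∧-zeroʳ b = refl
  split-order true  true  true  true  h _ = ⊥-elim (h refl refl)
  split-order true  false true  true  _ _ = refl
  split-order false true  true  true  _ _ = refl
  split-order false false true  true  _ h = ⊥-elim (not-¬ (h refl) refl)

  distinct : ∀ x y → p x y ≡ true → ¬ x ≡ y
  distinct x .x e refl = not-¬ (across x x e) (xor-same (S x))

  split-by-side : ∀ x y → 𝟙 ((x <ᶠ y) ∧ p x y) ≡ A x y + C x y
  split-by-side x y = split-xor (x <ᶠ y) (S x) (S y) (p x y) (across x y)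

  split-by-order : ∀ x y → 𝟙 (S x ∧ p x y) ≡ A x y + B x y
  split-by-order x y =
    split-order (x <ᶠ y) (y <ᶠ x) (S x) (p x y) (<ᶠ-asym x y) (<ᶠ-total x y ∘ distinct x y)

betweenᵇ-comm : ∀ a b c → betweenᵇ a b c ≡ betweenᵇ b a c
betweenᵇ-comm a b c = ∨-comm ((a <ᵇ c) ∧ (c <ᵇ b)) ((b <ᵇ c) ∧ (c <ᵇ a))

betweenᵇ-sound : ∀ {a b} c → a < b → betweenᵇ a b c ≡ true → a < c × c < b
betweenᵇ-sound {a} {b} c a<b e with ∨≡true⇒⊎ e
... | inj₁ q = <ᵇ≡true⇒< a c (∧-conicalˡ _ _ q) , <ᵇ≡true⇒< c b (∧-conicalʳ (a <ᵇ c) _ q)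
... | inj₂ q = ⊥-elim (<-asym a<b (<-trans (<ᵇ≡true⇒< b c (∧-conicalˡ _ _ q))
                                           (<ᵇ≡true⇒< c a (∧-conicalʳ (b <ᵇ c) _ q))))

betweenᵇ-complete : ∀ {a b c} → a < c → c < b → betweenᵇ a b c ≡ true
betweenᵇ-complete {a} {b} {c} a<c c<b =
  cong (_∨ ((b <ᵇ c) ∧ (c <ᵇ a))) (cong₂ _∧_ (<⇒<ᵇ≡true a<c) (<⇒<ᵇ≡true c<b))

betweenᵇ-false : ∀ {a b} c → a < b → ¬ (a < c × c < b) → betweenᵇ a b c ≡ false
betweenᵇ-false c a<b ¬inside = ¬-not (¬inside ∘ betweenᵇ-sound c a<b)

betweenᵇ-outside : ∀ {a b c} → a < b → c < a ⊎ b < c → betweenᵇ a b c ≡ false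
betweenᵇ-outside {a} {b} {c} a<b outside = betweenᵇ-false c a<b (λ (a<c , c<b) → excluded a<c c<b outside)
  where
  excluded : a < c → c < b → c < a ⊎ b < c → ⊥
  excluded a<c _   (inj₁ c<a) = <-asym a<c c<a
  excluded _   c<b (inj₂ b<c) = <-asym c<b b<c

betweenᵇ-same : ∀ a c → betweenᵇ a a c ≡ false
betweenᵇ-same a c = ¬-not (λ e → [ empty , empty ] (∨≡true⇒⊎ e))
  where
  empty : (a <ᵇ c) ∧ (c <ᵇ a) ≡ true → ⊥
  empty e = <-asym (<ᵇ≡true⇒< a c (∧-conicalˡ _ _ e)) (<ᵇ≡true⇒< c a (∧-conicalʳ (a <ᵇ c) _ e))

betweenᵇ-step : ∀ {a b c} → a < b → ¬ c ≡ a → ¬ suc c ≡ b → betweenᵇ a b c ≡ betweenᵇ a b (suc c)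
betweenᵇ-step {a} {b} {c} a<b c≢a c+1≢b with a <? c | c <? b
... | yes a<c | yes c<b = trans (betweenᵇ-complete a<c c<b)
                               (sym (betweenᵇ-complete (<-trans a<c (n<1+n c)) (≤∧≢⇒< c<b c+1≢b)))
... | no  a≮c | _       = trans (betweenᵇ-false c a<b (a≮c ∘ proj₁))
                               (sym (betweenᵇ-false (suc c) a<b
                                      (λ (a<c+1 , _) → a≮c (≤∧≢⇒< (≤-pred a<c+1) (c≢a ∘ sym)))))
... | yes _   | no  c≮b = trans (betweenᵇ-false c a<b (c≮b ∘ proj₂))
                               (sym (betweenᵇ-false (suc c) a<b (λ (_ , c+1<b) → c≮b (<-trans (n<1+n c) c+1<b))))

betweenᵇ-adjacent : ∀ a c → betweenᵇ a (suc a) c ≡ false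
betweenᵇ-adjacent a c =
  betweenᵇ-false c (n<1+n a) (λ (a<c , c<a+1) → <-irrefl refl (<-≤-trans a<c (≤-pred c<a+1)))

betweenᵇ-complement : ∀ {a b} c → b < a → ¬ c ≡ a → ¬ c ≡ b →
                      (c <ᵇ b) ∨ (a <ᵇ c) ≡ not (betweenᵇ a b c)
betweenᵇ-complement {a} {b} c b<a c≢a c≢b with <-cmp c b
... | tri< c<b _ _ = trans (cong (_∨ (a <ᵇ c)) (<⇒<ᵇ≡true c<b))
                          (sym (cong not (inside-false (λ (b<c , _) → <-asym b<c c<b))))
  where
  inside-false : ¬ (b < c × c < a) → betweenᵇ a b c ≡ false
  inside-false h = trans (betweenᵇ-comm a b c) (betweenᵇ-false c b<a h)
... | tri≈ _ c≡b _ = ⊥-elim (c≢b c≡b)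
... | tri> _ _ b<c with <-cmp c a
...   | tri< c<a _ _ = trans (cong₂ _∨_ (≥⇒<ᵇ≡false (<⇒≤ b<c)) (≥⇒<ᵇ≡false (<⇒≤ c<a)))
                             (sym (cong not (trans (betweenᵇ-comm a b c) (betweenᵇ-complete b<c c<a))))
...   | tri≈ _ c≡a _ = ⊥-elim (c≢a c≡a)
...   | tri> _ _ a<c = trans (cong₂ _∨_ (≥⇒<ᵇ≡false (<⇒≤ b<c)) (<⇒<ᵇ≡true a<c))
                             (sym (cong not (trans (betweenᵇ-comm a b c)
                                                   (betweenᵇ-false c b<a (λ (_ , c<a) → <-asym c<a a<c)))))

record Crosses (a b c e : ℕ) : Set where
  field
    c≢a : ¬ c ≡ a
    c≢b : ¬ c ≡ b
    e≢a : ¬ e ≡ a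
    e≢b : ¬ e ≡ b
    separated : betweenᵇ a b c xor betweenᵇ a b e ≡ true

crossᵇ-sound : ∀ a b c e → crossᵇ a b c e ≡ true → Crosses a b c e
crossᵇ-sound a b c e h with a ≡ᵇ c in ac | a ≡ᵇ e in ae | b ≡ᵇ c in bc | b ≡ᵇ e in be
... | false | false | false | false = record
  { c≢a = ≡ᵇ≡false⇒≢ a c ac ∘ sym
  ; c≢b = ≡ᵇ≡false⇒≢ b c bc ∘ sym
  ; e≢a = ≡ᵇ≡false⇒≢ a e ae ∘ sym
  ; e≢b = ≡ᵇ≡false⇒≢ b e be ∘ sym
  ; separated = h
  }

crossᵇ-intro : ∀ a b c e → ¬ c ≡ a → ¬ c ≡ b → ¬ e ≡ a → ¬ e ≡ b →
               betweenᵇ a b c xor betweenᵇ a b e ≡ true → crossᵇ a b c e ≡ true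
crossᵇ-intro a b c e c≢a c≢b e≢a e≢b sep
  rewrite ≢⇒≡ᵇ≡false a c (c≢a ∘ sym) | ≢⇒≡ᵇ≡false a e (e≢a ∘ sym)
        | ≢⇒≡ᵇ≡false b c (c≢b ∘ sym) | ≢⇒≡ᵇ≡false b e (e≢b ∘ sym) = sep

crossᵇ-swapˡ : ∀ a b c e → crossᵇ a b c e ≡ crossᵇ b a c e
crossᵇ-swapˡ a b c e rewrite betweenᵇ-comm a b c | betweenᵇ-comm a b e
  with a ≡ᵇ c | a ≡ᵇ e | b ≡ᵇ c | b ≡ᵇ e
... | false | false | false | false = refl
... | false | false | false | true  = refl
... | false | false | true  | _     = refl
... | false | true  | false | false = refl
... | false | true  | false | true  = refl
... | false | true  | true  | _     = refl
... | true  | _     | false | false = refl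
... | true  | _     | false | true  = refl
... | true  | _     | true  | _     = refl

crossᵇ-swapʳ : ∀ a b c e → crossᵇ a b c e ≡ crossᵇ a b e c
crossᵇ-swapʳ a b c e with a ≡ᵇ c | a ≡ᵇ e | b ≡ᵇ c | b ≡ᵇ e
... | false | false | false | false = xor-comm (betweenᵇ a b c) (betweenᵇ a b e)
... | false | false | false | true  = refl
... | false | false | true  | false = refl
... | false | false | true  | true  = refl
... | false | true  | false | false = refl
... | false | true  | false | true  = refl
... | false | true  | true  | false = refl
... | false | true  | true  | true  = refl
... | true  | false | false | false = refl
... | true  | false | false | true  = refl
... | true  | false | true  | false = refl
... | true  | false | true  | true  = refl
... | true  | true  | false | false = refl
... | true  | true  | false | true  = refl
... | true  | true  | true  | false = refl
... | true  | true  | true  | true  = refl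

not-separated : ∀ a b c e → betweenᵇ a b c ≡ betweenᵇ a b e → crossᵇ a b c e ≡ true → ⊥
not-separated a b c e same h =
  not-¬ (Crosses.separated (crossᵇ-sound a b c e h))
        (trans (cong (_xor betweenᵇ a b e) same) (xor-same (betweenᵇ a b e)))

crossᵇ-adjacentˡ : ∀ a c e → crossᵇ a (suc a) c e ≡ false
crossᵇ-adjacentˡ a c e =
  ¬-not (not-separated a (suc a) c e (trans (betweenᵇ-adjacent a c) (sym (betweenᵇ-adjacent a e))))

crossᵇ-adjacentʳ : ∀ a b c → crossᵇ a b c (suc c) ≡ false
crossᵇ-adjacentʳ a b c = ¬-not (λ h → not-separated a b c (suc c) (same (Crosses.c≢a (X h)) (Crosses.c≢b (X h))
                                                       (Crosses.e≢a (X h)) (Crosses.e≢b (X h))) h)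
  where
  X : crossᵇ a b c (suc c) ≡ true → Crosses a b c (suc c)
  X = crossᵇ-sound a b c (suc c)
  same : ¬ c ≡ a → ¬ c ≡ b → ¬ suc c ≡ a → ¬ suc c ≡ b → betweenᵇ a b c ≡ betweenᵇ a b (suc c)
  same c≢a c≢b c+1≢a c+1≢b with <-cmp a b
  ... | tri< a<b _ _ = betweenᵇ-step a<b c≢a c+1≢b
  ... | tri≈ _ refl _ = trans (betweenᵇ-same a c) (sym (betweenᵇ-same a (suc c)))
  ... | tri> _ _ b<a = trans (betweenᵇ-comm a b c)
                             (trans (betweenᵇ-step b<a c≢b c+1≢a) (sym (betweenᵇ-comm a b (suc c))))

crossᵇ-inside-outside : ∀ {a b c e} → a < c → c < b → e < a ⊎ b < e → crossᵇ a b c e ≡ true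
crossᵇ-inside-outside {a} {b} {c} {e} a<c c<b outside =
  crossᵇ-intro a b c e (λ c≡a → <-irrefl (sym c≡a) a<c) (λ c≡b → <-irrefl c≡b c<b) e≢a e≢b
               (subst₂ (λ x y → x xor y ≡ true)
                       (sym (betweenᵇ-complete a<c c<b)) (sym (betweenᵇ-outside a<b outside)) refl)
  where
  a<b = <-trans a<c c<b
  e≢a : ¬ e ≡ a
  e≢a e≡a = [ <-irrefl e≡a , (λ b<e → <-asym a<b (subst (b <_) e≡a b<e)) ] outside
  e≢b : ¬ e ≡ b
  e≢b e≡b = [ (λ e<a → <-asym a<b (subst (_< a) e≡b e<a)) , <-irrefl (sym e≡b) ] outside

-- The cylinder C_m □ P_d

-- Fewer than 2d vertices cannot separate two sets of
-- T = 2d² vertices; an edge is short if it spans fewer than s = T + 2d points of the circle, and m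
-- leaves room for two cut points near 2s and 6s.
module Cylinder (d′ : ℕ) where

  d : ℕ
  d = suc d′

  T : ℕ
  T = 2 * d * d

  s : ℕ
  s = T + 2 * d

  abstract
    m : ℕ
    m = 8 * s + 8

    m≡8s+8 : m ≡ 8 * s + 8
    m≡8s+8 = refl

  N : ℕ
  N = m * d

  V : Set
  V = Fin N

  -- Fin N lists the vertices column by column.
  abstract
    col : V → ℕ
    col v = toℕ (proj₁ (remQuot {m} d v))

    row : V → ℕ
    row v = toℕ (proj₂ (remQuot {m} d v))

    toℕ≡col-row : ∀ v → toℕ v ≡ d * col v + row v
    toℕ≡col-row v = trans (cong toℕ (sym (FP.combine-remQuot {m} d v)))
                          (FP.toℕ-combine (proj₁ (remQuot {m} d v)) (proj₂ (remQuot {m} d v)))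

    col<m : ∀ v → col v < m
    col<m v = FP.toℕ<n (proj₁ (remQuot {m} d v))

    row<d : ∀ v → row v < d
    row<d v = FP.toℕ<n (proj₂ (remQuot {m} d v))

    col-combine : ∀ (b : Fin m) (o : Fin d) → col (combine b o) ≡ toℕ b
    col-combine b o = cong (toℕ ∘ proj₁) (FP.remQuot-combine {m} {d} b o)

    row-combine : ∀ (b : Fin m) (o : Fin d) → row (combine b o) ≡ toℕ o
    row-combine b o = cong (toℕ ∘ proj₂) (FP.remQuot-combine {m} {d} b o)

  8≤m : 8 ≤ m
  8≤m = subst (8 ≤_) (sym m≡8s+8) (m≤n+m 8 (8 * s))

  coords-injective : ∀ {v w} → col v ≡ col w → row v ≡ row w → v ≡ w
  coords-injective {v} {w} c r = FP.toℕ-injective (begin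
    toℕ v              ≡⟨ toℕ≡col-row v ⟩
    d * col v + row v  ≡⟨ cong₂ (λ x y → d * x + y) c r ⟩
    d * col w + row w  ≡⟨ toℕ≡col-row w ⟨
    toℕ w              ∎)
    where open ≡-Reasoning

  vertex : ∀ b o → .(b < m) → .(o < d) → V
  vertex b o b<m o<d = combine (fromℕ< b<m) (fromℕ< o<d)

  col-vertex : ∀ {b o} .(b<m : b < m) .(o<d : o < d) → col (vertex b o b<m o<d) ≡ b
  col-vertex b<m o<d = trans (col-combine (fromℕ< b<m) (fromℕ< o<d)) (FP.toℕ-fromℕ< b<m)

  row-vertex : ∀ {b o} .(b<m : b < m) .(o<d : o < d) → row (vertex b o b<m o<d) ≡ o
  row-vertex b<m o<d = trans (row-combine (fromℕ< b<m) (fromℕ< o<d)) (FP.toℕ-fromℕ< o<d)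

  abstract
    next : ℕ → ℕ
    next b = if suc b ≡ᵇ m then 0 else suc b

    next-cases : ∀ b → (suc b ≡ m × next b ≡ 0) ⊎ (¬ suc b ≡ m × next b ≡ suc b)
    next-cases b with suc b ≡ᵇ m in e
    ... | true  = inj₁ (≡ᵇ≡true⇒≡ (suc b) m e , refl)
    ... | false = inj₂ (≡ᵇ≡false⇒≢ (suc b) m e , refl)

  next-injective : ∀ {a b} → next a ≡ next b → a ≡ b
  next-injective {a} {b} h with next-cases a | next-cases b
  ... | inj₁ (a+1≡m , _) | inj₁ (b+1≡m , _) = suc-injective (trans a+1≡m (sym b+1≡m))
  ... | inj₁ (_ , ea)    | inj₂ (_ , eb)    = ⊥-elim (0≢1+n (trans (sym ea) (trans h eb)))
  ... | inj₂ (_ , ea)    | inj₁ (_ , eb)    = ⊥-elim (0≢1+n (trans (sym eb) (trans (sym h) ea)))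
  ... | inj₂ (_ , ea)    | inj₂ (_ , eb)    = suc-injective (trans (sym ea) (trans h eb))

  m≢1 : ¬ m ≡ 1
  m≢1 m≡1 with subst (8 ≤_) m≡1 8≤m
  ... | s≤s ()

  b≢next-b : ∀ b → ¬ b ≡ next b
  b≢next-b b b≡next with next-cases b
  ... | inj₁ (b+1≡m , e) = m≢1 (trans (sym b+1≡m) (cong suc (trans b≡next e)))
  ... | inj₂ (_ , e)     = 1+n≢n (sym (trans b≡next e))

  verticalᵇ : V → V → Bool
  verticalᵇ v w = (col v ≡ᵇ col w) ∧ ((suc (row v) ≡ᵇ row w) ∨ (suc (row w) ≡ᵇ row v))

  horizontalᵇ : V → V → Bool
  horizontalᵇ v w = (row v ≡ᵇ row w) ∧ ((col w ≡ᵇ next (col v)) ∨ (col v ≡ᵇ next (col w)))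

  adjᶜ : V → V → Bool
  adjᶜ v w = verticalᵇ v w ∨ horizontalᵇ v w

  adjᶜ-sym : ∀ v w → adjᶜ v w ≡ adjᶜ w v
  adjᶜ-sym v w
    rewrite ≡ᵇ-comm (col v) (col w) | ≡ᵇ-comm (row v) (row w)
          | ∨-comm (suc (row v) ≡ᵇ row w) (suc (row w) ≡ᵇ row v)
          | ∨-comm (col w ≡ᵇ next (col v)) (col v ≡ᵇ next (col w)) = refl

  adjᶜ-irrefl : ∀ v → adjᶜ v v ≡ false
  adjᶜ-irrefl v
    rewrite ≡⇒≡ᵇ≡true {col v} refl | ≡⇒≡ᵇ≡true {row v} refl
          | ≢⇒≡ᵇ≡false (suc (row v)) (row v) 1+n≢n
          | ≢⇒≡ᵇ≡false (col v) (next (col v)) (b≢next-b (col v)) = refl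

  G : Graph
  G = record { n = N ; adj = adjᶜ ; sym = adjᶜ-sym ; irrefl = adjᶜ-irrefl }

  Vertical : V → V → Set
  Vertical v w = col v ≡ col w × suc (row v) ≡ row w

  Horizontal : V → V → Set
  Horizontal v w = row v ≡ row w × col w ≡ next (col v)

  edge-cases : ∀ {v w} → adjᶜ v w ≡ true → Vertical v w ⊎ Vertical w v ⊎ Horizontal v w ⊎ Horizontal w v
  edge-cases {v} {w} e with ∨≡true⇒⊎ {verticalᵇ v w} e
  ... | inj₁ ver with ∨≡true⇒⊎ (∧-conicalʳ _ _ ver)
  ...   | inj₁ up   = inj₁ (same-col , ≡ᵇ≡true⇒≡ _ _ up)
    where same-col = ≡ᵇ≡true⇒≡ (col v) (col w) (∧-conicalˡ _ _ ver)
  ...   | inj₂ down = inj₂ (inj₁ (sym same-col , ≡ᵇ≡true⇒≡ _ _ down))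
    where same-col = ≡ᵇ≡true⇒≡ (col v) (col w) (∧-conicalˡ _ _ ver)
  edge-cases {v} {w} e | inj₂ hor with ∨≡true⇒⊎ (∧-conicalʳ _ _ hor)
  ...   | inj₁ right = inj₂ (inj₂ (inj₁ (same-row , ≡ᵇ≡true⇒≡ _ _ right)))
    where same-row = ≡ᵇ≡true⇒≡ (row v) (row w) (∧-conicalˡ _ _ hor)
  ...   | inj₂ left  = inj₂ (inj₂ (inj₂ (sym same-row , ≡ᵇ≡true⇒≡ _ _ left)))
    where same-row = ≡ᵇ≡true⇒≡ (row v) (row w) (∧-conicalˡ _ _ hor)

  vertical⇒adjᶜ : ∀ {v w} → Vertical v w → adjᶜ v w ≡ true
  vertical⇒adjᶜ {v} {w} (c , r) rewrite ≡⇒≡ᵇ≡true c | ≡⇒≡ᵇ≡true r = refl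

  horizontal⇒adjᶜ : ∀ {v w} → Horizontal v w → adjᶜ v w ≡ true
  horizontal⇒adjᶜ {v} {w} (r , c) rewrite ≡⇒≡ᵇ≡true r | ≡⇒≡ᵇ≡true c =
    ∨≡trueʳ (verticalᵇ v w) refl

  adjᶜ-flip : ∀ {v w} → adjᶜ v w ≡ true → adjᶜ w v ≡ true
  adjᶜ-flip {v} {w} = trans (adjᶜ-sym w v)

  vertical⇒consecutive : ∀ {v w} → Vertical v w → toℕ w ≡ suc (toℕ v)
  vertical⇒consecutive {v} {w} (c , r) = begin
    toℕ w                    ≡⟨ toℕ≡col-row w ⟩
    d * col w + row w        ≡⟨ cong₂ (λ x y → d * x + y) (sym c) (sym r) ⟩
    d * col v + suc (row v)  ≡⟨ +-suc (d * col v) (row v) ⟩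
    suc (d * col v + row v)  ≡⟨ cong suc (toℕ≡col-row v) ⟨
    suc (toℕ v)              ∎
    where open ≡-Reasoning

  horizontal-degree : ∀ x → count (horizontalᵇ x) ≤ 2
  horizontal-degree x = begin
    count (horizontalᵇ x)                 ≤⟨ count-mono {q = λ y → right y ∨ left y} split ⟩
    count (λ y → right y ∨ left y)        ≤⟨ count-∨ right left ⟩
    count right + count left              ≤⟨ +-mono-≤ (count-≤1 right right-unique)
                                                      (count-≤1 left left-unique) ⟩
    2                                     ∎
    where
    open ≤-Reasoning
    right left : V → Bool
    right y = (row x ≡ᵇ row y) ∧ (col y ≡ᵇ next (col x))
    left  y = (row x ≡ᵇ row y) ∧ (col x ≡ᵇ next (col y))
    split : ∀ y → horizontalᵇ x y ≡ true → right y ∨ left y ≡ true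
    split y e with ∨≡true⇒⊎ {col y ≡ᵇ next (col x)} (∧-conicalʳ (row x ≡ᵇ row y) _ e)
    ... | inj₁ r = cong (_∨ left y) (cong₂ _∧_ (∧-conicalˡ (row x ≡ᵇ row y) _ e) r)
    ... | inj₂ l = ∨≡trueʳ (right y) (cong₂ _∧_ (∧-conicalˡ (row x ≡ᵇ row y) _ e) l)
    same-row : ∀ {i j b b′} → (row x ≡ᵇ row i) ∧ b ≡ true → (row x ≡ᵇ row j) ∧ b′ ≡ true →
               row i ≡ row j
    same-row {i} {j} ei ej = trans (sym (≡ᵇ≡true⇒≡ (row x) (row i) (∧-conicalˡ _ _ ei)))
                                   (≡ᵇ≡true⇒≡ (row x) (row j) (∧-conicalˡ _ _ ej))
    col-right : ∀ {i} → right i ≡ true → col i ≡ next (col x)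
    col-right {i} e = ≡ᵇ≡true⇒≡ (col i) _ (∧-conicalʳ (row x ≡ᵇ row i) _ e)
    col-left : ∀ {i} → left i ≡ true → col x ≡ next (col i)
    col-left {i} e = ≡ᵇ≡true⇒≡ (col x) _ (∧-conicalʳ (row x ≡ᵇ row i) _ e)
    right-unique : ∀ i j → right i ≡ true → right j ≡ true → i ≡ j
    right-unique i j ei ej = coords-injective (trans (col-right ei) (sym (col-right ej))) (same-row ei ej)
    left-unique : ∀ i j → left i ≡ true → left j ≡ true → i ≡ j
    left-unique i j ei ej =
      coords-injective (next-injective (trans (sym (col-left ei)) (col-left ej))) (same-row ei ej)

  verticalᵇ-consecutive : ∀ {x y} → verticalᵇ x y ≡ true →
                          toℕ y ≡ suc (toℕ x) ⊎ toℕ x ≡ suc (toℕ y)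
  verticalᵇ-consecutive {x} {y} e
    with ∨≡true⇒⊎ {suc (row x) ≡ᵇ row y} (∧-conicalʳ (col x ≡ᵇ col y) _ e)
  ... | inj₁ up   = inj₁ (vertical⇒consecutive (same-col , ≡ᵇ≡true⇒≡ _ _ up))
    where same-col = ≡ᵇ≡true⇒≡ (col x) (col y) (∧-conicalˡ (col x ≡ᵇ col y) _ e)
  ... | inj₂ down = inj₂ (vertical⇒consecutive (sym same-col , ≡ᵇ≡true⇒≡ _ _ down))
    where same-col = ≡ᵇ≡true⇒≡ (col x) (col y) (∧-conicalˡ (col x ≡ᵇ col y) _ e)

  crossingᵇ : (V → ℕ) → ℕ → ℕ → V → V → Bool
  crossingᵇ π a b x y = adjᶜ x y ∧ crossᵇ a b (π x) (π y)

  crossingᵇ-sym : ∀ π a b x y → crossingᵇ π a b x y ≡ crossingᵇ π a b y x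
  crossingᵇ-sym π a b x y = cong₂ _∧_ (adjᶜ-sym x y) (crossᵇ-swapʳ a b (π x) (π y))

  crossings-comm : ∀ π a b → countPairs (crossingᵇ π a b) ≡ countPairs (crossingᵇ π b a)
  crossings-comm π a b = countPairs-cong (λ x y → cong (adjᶜ x y ∧_) (crossᵇ-swapˡ a b (π x) (π y)))

  crossingᵇ-crosses : ∀ {π a b x y} → crossingᵇ π a b x y ≡ true → Crosses a b (π x) (π y)
  crossingᵇ-crosses {π} {a} {b} {x} {y} = crossᵇ-sound a b (π x) (π y) ∘ ∧-conicalʳ (adjᶜ x y) _

  -- lcr° ≤ 2d′

  -- Vertical edges join neighbouring points of the circle, so they cross nothing.
  crossing-horizontal : ∀ a b x y → crossingᵇ toℕ a b x y ≡ true → horizontalᵇ x y ≡ true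
  crossing-horizontal a b x y e with verticalᵇ x y in ver
  ... | false = ∧-conicalˡ (horizontalᵇ x y) _ e
  ... | true with verticalᵇ-consecutive ver
  ...   | inj₁ y≡x+1 = ⊥-elim (not-¬ (∧-conicalʳ true _ e)
                                     (trans (cong (crossᵇ a b (toℕ x)) y≡x+1) (crossᵇ-adjacentʳ a b (toℕ x))))
  ...   | inj₂ x≡y+1 = ⊥-elim (not-¬ (∧-conicalʳ true _ e)
                                     (trans (crossᵇ-swapʳ a b (toℕ x) (toℕ y))
                                            (trans (cong (crossᵇ a b (toℕ y)) x≡y+1)
                                                   (crossᵇ-adjacentʳ a b (toℕ y)))))

  -- Every crossing edge is horizontal, and each vertex has at most two horizontal edges.
  crossings-≤-2∣S∣ : ∀ a b (S : V → Bool) →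
                     (∀ x y → crossingᵇ toℕ a b x y ≡ true → S x xor S y ≡ true) →
                     countPairs (crossingᵇ toℕ a b) ≤ 2 * count S
  crossings-≤-2∣S∣ a b S across = begin
    countPairs (crossingᵇ toℕ a b)
      ≡⟨ countPairs-across S _ (crossingᵇ-sym toℕ a b) across ⟩
    sum (λ x → count (λ y → S x ∧ crossingᵇ toℕ a b x y))    ≤⟨ sum-mono-≤ at-most-two ⟩
    sum (λ x → 2 * 𝟙 (S x))                                  ≡⟨ sum-*ˡ 2 (𝟙 ∘ S) ⟩
    2 * sum (𝟙 ∘ S)                                          ≡⟨ cong (2 *_) (count≡∑𝟙 S) ⟨
    2 * count S                                              ∎
    where
    open ≤-Reasoning
    at-most-two : ∀ x → count (λ y → S x ∧ crossingᵇ toℕ a b x y) ≤ 2 * 𝟙 (S x)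
    at-most-two x with S x
    ... | false = ≤-reflexive (count-all-false {N} (λ _ → refl))
    ... | true  = ≤-trans (count-mono (crossing-horizontal a b x)) (horizontal-degree x)

  crossings-inside : ∀ {a b} → a < b → b ≤ N → countPairs (crossingᵇ toℕ a b) ≤ 2 * (b ∸ suc a)
  crossings-inside {a} {b} a<b b≤N =
    ≤-trans (crossings-≤-2∣S∣ a b side across) (*-monoʳ-≤ 2 count-side)
    where
    side : V → Bool
    side x = betweenᵇ a b (toℕ x)
    across : ∀ x y → crossingᵇ toℕ a b x y ≡ true → side x xor side y ≡ true
    across x y = Crosses.separated ∘ crossingᵇ-crosses {toℕ} {a} {b}
    count-side : count side ≤ b ∸ suc a
    count-side = begin
      count side                                              ≤⟨ count-mono {N} strictly-between ⟩
      count {N} (λ x → (a <ᵇ toℕ x) ∧ (toℕ x <ᵇ b))           ≡⟨ m+n∸n≡m _ (suc a) ⟨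
      count {N} (λ x → (a <ᵇ toℕ x) ∧ (toℕ x <ᵇ b)) + suc a ∸ suc a
                                                              ≡⟨ cong (_∸ suc a) (count-between a b a<b b≤N) ⟩
      b ∸ suc a                                               ∎
      where
      open ≤-Reasoning
      strictly-between : ∀ x → side x ≡ true → (a <ᵇ toℕ x) ∧ (toℕ x <ᵇ b) ≡ true
      strictly-between x e = let (a<x , x<b) = betweenᵇ-sound (toℕ x) a<b e
                             in cong₂ _∧_ (<⇒<ᵇ≡true a<x) (<⇒<ᵇ≡true x<b)

  crossings-outside : ∀ {a b} → a < b → b < N → countPairs (crossingᵇ toℕ a b) ≤ 2 * (a + (N ∸ suc b))
  crossings-outside {a} {b} a<b b<N =
    ≤-trans (crossings-≤-2∣S∣ a b side across) (*-monoʳ-≤ 2 count-side)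
    where
    side : V → Bool
    side x = (toℕ x <ᵇ a) ∨ (b <ᵇ toℕ x)
    side≡not-between : ∀ x → ¬ toℕ x ≡ a → ¬ toℕ x ≡ b → side x ≡ not (betweenᵇ a b (toℕ x))
    side≡not-between x x≢a x≢b =
      trans (betweenᵇ-complement (toℕ x) a<b x≢b x≢a) (cong not (betweenᵇ-comm b a (toℕ x)))
    across : ∀ x y → crossingᵇ toℕ a b x y ≡ true → side x xor side y ≡ true
    across x y e = begin
      side x xor side y
        ≡⟨ cong₂ _xor_ (side≡not-between x c≢a c≢b) (side≡not-between y e≢a e≢b) ⟩
      not (betweenᵇ a b (toℕ x)) xor not (betweenᵇ a b (toℕ y))
        ≡⟨ xor-annihilates-not (betweenᵇ a b (toℕ x)) (betweenᵇ a b (toℕ y)) ⟩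
      betweenᵇ a b (toℕ x) xor betweenᵇ a b (toℕ y)
        ≡⟨ separated ⟩
      true ∎
      where
      open Crosses (crossingᵇ-crosses {toℕ} {a} {b} e)
      open ≡-Reasoning
    count-side : count side ≤ a + (N ∸ suc b)
    count-side = begin
      count side
        ≤⟨ count-∨ {N} (λ x → toℕ x <ᵇ a) (λ x → b <ᵇ toℕ x) ⟩
      count {N} (λ x → toℕ x <ᵇ a) + count {N} (λ x → b <ᵇ toℕ x)
        ≡⟨ cong₂ _+_ (count-< a (<⇒≤ (<-trans a<b b<N))) above ⟩
      a + (N ∸ suc b) ∎
      where
      open ≤-Reasoning
      above : count {N} (λ x → b <ᵇ toℕ x) ≡ N ∸ suc b
      above = trans (sym (m+n∸n≡m _ (suc b))) (cong (_∸ suc b) (count-> b b<N))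

  horizontal-crossings : ∀ {u v} → Horizontal u v →
                         countPairs (crossingᵇ toℕ (toℕ u) (toℕ v)) ≤ 2 * d′
  horizontal-crossings {u} {v} (r , c) with next-cases (col u)
  ... | inj₂ (_ , col-v) =
    ≤-trans (crossings-inside u<v (<⇒≤ (FP.toℕ<n v))) (≤-reflexive (cong (2 *_) gap))
    where
    toℕ-v : toℕ v ≡ toℕ u + d
    toℕ-v = begin
      toℕ v                    ≡⟨ toℕ≡col-row v ⟩
      d * col v + row v        ≡⟨ cong₂ (λ x y → d * x + y) (trans c col-v) (sym r) ⟩
      d * suc (col u) + row u  ≡⟨ solve 3 (λ d c o → d :* (con 1 :+ c) :+ o := (d :* c :+ o) :+ d)
                                          refl d (col u) (row u) ⟩
      d * col u + row u + d    ≡⟨ cong (_+ d) (toℕ≡col-row u) ⟨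
      toℕ u + d                ∎
      where open ≡-Reasoning
    u<v : toℕ u < toℕ v
    u<v = subst (toℕ u <_) (sym toℕ-v) (m<m+n (toℕ u) (s≤s z≤n))
    gap : toℕ v ∸ suc (toℕ u) ≡ d′
    gap = trans (cong (_∸ suc (toℕ u)) (trans toℕ-v (+-suc (toℕ u) d′))) (m+n∸m≡n (suc (toℕ u)) d′)
  ... | inj₁ (last , col-v) =
    subst (_≤ 2 * d′) (crossings-comm toℕ (toℕ v) (toℕ u))
          (≤-trans (crossings-outside v<u (FP.toℕ<n u)) (≤-reflexive (cong (2 *_) outside)))
    where
    open ≡-Reasoning
    b = col u
    o = row u
    toℕ-v : toℕ v ≡ o
    toℕ-v = begin
      toℕ v              ≡⟨ toℕ≡col-row v ⟩
      d * col v + row v  ≡⟨ cong₂ (λ x y → d * x + y) (trans c col-v) (sym r) ⟩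
      d * 0 + o          ≡⟨ cong (_+ o) (*-zeroʳ d) ⟩
      o                  ∎
    b>0 : 0 < b
    b>0 = n≢0⇒n>0 (λ b≡0 → m≢1 (trans (sym last) (cong suc b≡0)))
    v<u : toℕ v < toℕ u
    v<u = subst₂ _<_ (sym toℕ-v) (sym (toℕ≡col-row u)) (+-monoˡ-< o (<-≤-trans b>0 (m≤n*m b d)))
    N≡ : N ≡ d * b + d
    N≡ = begin
      m * d        ≡⟨ cong (_* d) last ⟨
      suc b * d    ≡⟨ +-comm d (b * d) ⟩
      b * d + d    ≡⟨ cong (_+ d) (*-comm b d) ⟩
      d * b + d    ∎
    outside : toℕ v + (N ∸ suc (toℕ u)) ≡ d′
    outside = begin
      toℕ v + (N ∸ suc (toℕ u))               ≡⟨ cong₂ (λ x y → x + (N ∸ suc y)) toℕ-v (toℕ≡col-row u) ⟩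
      o + (N ∸ suc (d * b + o))               ≡⟨ cong (λ z → o + (z ∸ suc (d * b + o))) N≡ ⟩
      o + ((d * b + d) ∸ suc (d * b + o))     ≡⟨ cong (λ z → o + ((d * b + d) ∸ z)) (+-suc (d * b) o) ⟨
      o + ((d * b + d) ∸ (d * b + suc o))     ≡⟨ cong (o +_) ([m+n]∸[m+o]≡n∸o (d * b) d (suc o)) ⟩
      o + (d′ ∸ o)                            ≡⟨ m+[n∸m]≡n (≤-pred (row<d u)) ⟩
      d′                                      ∎

  vertical-crossings : ∀ {u v} → Vertical u v → countPairs (crossingᵇ toℕ (toℕ u) (toℕ v)) ≡ 0
  vertical-crossings {u} {v} ver rewrite vertical⇒consecutive ver =
    countPairs-none (λ x y → trans (cong (adjᶜ x y ∧_) (crossᵇ-adjacentˡ (toℕ u) (toℕ x) (toℕ y)))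
                                   (∧-zeroʳ (adjᶜ x y)))

  identity-drawing : ∀ u v → adjᶜ u v ≡ true → crossings G id u v ≤ 2 * d′
  identity-drawing u v e with edge-cases e
  ... | inj₁ ver                = ≤-trans (≤-reflexive (vertical-crossings ver)) z≤n
  ... | inj₂ (inj₁ ver)         = ≤-trans (≤-reflexive (trans (crossings-comm toℕ (toℕ u) (toℕ v))
                                                              (vertical-crossings ver))) z≤n
  ... | inj₂ (inj₂ (inj₁ hor)) = horizontal-crossings hor
  ... | inj₂ (inj₂ (inj₂ hor)) =
    subst (_≤ 2 * d′) (crossings-comm toℕ (toℕ v) (toℕ u)) (horizontal-crossings hor)

  -- sn ≤ 2d

  column-size : ∀ c → count {N} (λ v → col v ≡ᵇ c) ≤ d
  column-size c = begin
    count {N} (λ v → col v ≡ᵇ c)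
      ≡⟨ count-combine {m} {d} (λ v → col v ≡ᵇ c) ⟩
    sum {m} (λ b → count {d} (λ o → col (combine b o) ≡ᵇ c))
      ≡⟨ sum-cong-≗ column ⟩
    sum {m} (λ b → d * 𝟙 (toℕ b ≡ᵇ c))
      ≡⟨ sum-*ˡ {m} d (λ b → 𝟙 (toℕ b ≡ᵇ c)) ⟩
    d * sum {m} (λ b → 𝟙 (toℕ b ≡ᵇ c))
      ≡⟨ cong (d *_) (count≡∑𝟙 {m} (λ b → toℕ b ≡ᵇ c)) ⟨
    d * count {m} (λ b → toℕ b ≡ᵇ c)
      ≤⟨ *-monoʳ-≤ d (count-≤1 {m} _ single) ⟩
    d * 1
      ≡⟨ *-identityʳ d ⟩
    d ∎
    where
    open ≤-Reasoning
    column : ∀ b → count {d} (λ o → col (combine b o) ≡ᵇ c) ≡ d * 𝟙 (toℕ b ≡ᵇ c)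
    column b with toℕ b ≡ᵇ c in e
    ... | false = trans (count-all-false (λ o → trans (cong (_≡ᵇ c) (col-combine b o)) e)) (sym (*-zeroʳ d))
    ... | true  = trans (count-all-true (λ o → trans (cong (_≡ᵇ c) (col-combine b o)) e)) (sym (*-identityʳ d))
    single : ∀ i j → (toℕ i ≡ᵇ c) ≡ true → (toℕ j ≡ᵇ c) ≡ true → i ≡ j
    single i j ei ej = FP.toℕ-injective (trans (≡ᵇ≡true⇒≡ _ c ei) (sym (≡ᵇ≡true⇒≡ _ c ej)))

  module BalancedCut (H : Subgraph G) where

    inH : V → Bool
    inH = Subgraph.S H

    size : ℕ
    size = count inH

    left : ℕ → ℕ
    left a = count (λ v → inH v ∧ (col v <ᵇ a))

    -- Cutting out the columns a and m - 1 leaves two balanced arcs.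
    Cut : ℕ → Set
    Cut a = a + 2 ≤ m × 3 * left a ≤ 2 * size × (size ≤ 3 * left (suc a) ⊎ a + 2 ≡ m)

    scan : ∀ k a → a + 2 + k ≡ m → 3 * left a ≤ 2 * size → ∃ Cut
    scan zero    a e h = a , ≤-reflexive a+2≡m , h , inj₂ a+2≡m
      where a+2≡m = trans (sym (+-identityʳ (a + 2))) e
    scan (suc k) a e h with 3 * left (suc a) <? size
    ... | no  3L≮size = a , ≤-trans (m≤m+n (a + 2) (suc k)) (≤-reflexive e) , h , inj₁ (≮⇒≥ 3L≮size)
    ... | yes 3L<size =
      scan k (suc a) (trans (sym (+-suc (a + 2) k)) e) (≤-trans (<⇒≤ 3L<size) (m≤m+n size (size + 0)))

    cut : ∃ Cut
    cut = scan (m ∸ 2) 0 (m+[n∸m]≡n (≤-trans (s≤s (s≤s z≤n)) 8≤m))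
               (≤-trans (≤-reflexive (cong (3 *_) (count-all-false (λ v → ∧-zeroʳ (inH v))))) z≤n)

    module _ (a : ℕ) (a-cut : Cut a) where

      A B : V → Bool
      A v = inH v ∧ ((col v <ᵇ suc a) ∨ (suc (col v) ≡ᵇ m))
      B v = inH v ∧ (a <ᵇ suc (col v))

      A∪B : ∀ v → A v ∨ B v ≡ inH v
      A∪B v with inH v | col v <ᵇ suc a in e
      ... | false | _     = refl
      ... | true  | true  = refl
      ... | true  | false =
        ∨≡trueʳ (suc (col v) ≡ᵇ m) (<⇒<ᵇ≡true (s≤s (<⇒≤ (<ᵇ≡false⇒≥ (col v) (suc a) e))))

      outside-B : ∀ {v} → inH v ≡ true → B v ≡ false → col v < a
      outside-B {v} h e = <ᵇ≡false⇒≥ a (suc (col v)) (subst (λ z → z ∧ (a <ᵇ suc (col v)) ≡ false) h e)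

      outside-A : ∀ {v} → inH v ≡ true → A v ≡ false → a < col v × ¬ suc (col v) ≡ m
      outside-A {v} h e =
        <ᵇ≡false⇒≥ (col v) (suc a) (∨-conicalˡ _ _ e′) , ≡ᵇ≡false⇒≢ _ _ (∨-conicalʳ _ _ e′)
        where e′ = subst (λ z → z ∧ ((col v <ᵇ suc a) ∨ (suc (col v) ≡ᵇ m)) ≡ false) h e

      only-A : ∀ {v} → A v ∧ not (B v) ≡ true → inH v ≡ true × col v < a
      only-A {v} e = h , outside-B h (not-injective (∧-conicalʳ (A v) _ e))
        where h = ∧-conicalˡ (inH v) _ (∧-conicalˡ (A v) _ e)

      only-B : ∀ {v} → B v ∧ not (A v) ≡ true → inH v ≡ true × a < col v × ¬ suc (col v) ≡ m
      only-B {v} e = h , outside-A h (not-injective (∧-conicalʳ (B v) _ e))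
        where h = ∧-conicalˡ (inH v) _ (∧-conicalˡ (B v) _ e)

      in-both : ∀ {v} → A v ∧ B v ≡ true → col v ≡ a ⊎ suc (col v) ≡ m
      in-both {v} e with ∨≡true⇒⊎ {col v <ᵇ suc a} (∧-conicalʳ (inH v) _ (∧-conicalˡ (A v) _ e))
      ... | inj₁ c≤a = inj₁ (≤-antisym (≤-pred (<ᵇ≡true⇒< _ _ c≤a))
                                       (≤-pred (<ᵇ≡true⇒< a _ (∧-conicalʳ (inH v) _ (∧-conicalʳ (A v) _ e)))))
      ... | inj₂ last = inj₂ (≡ᵇ≡true⇒≡ _ _ last)

      no-edge : ∀ u v → A u ∧ not (B u) ≡ true → B v ∧ not (A v) ≡ true → adjᶜ u v ≡ true → ⊥
      no-edge u v eu ev e with only-A eu | only-B ev | edge-cases e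
      ... | _ , u<a | _ , a<v , _ | inj₁ (c , _) = <-irrefl c (<-trans u<a a<v)
      ... | _ , u<a | _ , a<v , _ | inj₂ (inj₁ (c , _)) = <-irrefl (sym c) (<-trans u<a a<v)
      ... | _ , u<a | _ , a<v , _ | inj₂ (inj₂ (inj₁ (_ , c))) with next-cases (col u)
      ...   | inj₁ (wrap , _) = <-irrefl wrap (<-≤-trans (s≤s (<-trans u<a a<v)) (col<m v))
      ...   | inj₂ (_ , nx)   = <-irrefl refl (<-≤-trans a<v (subst (_≤ a) (sym (trans c nx)) u<a))
      no-edge u v eu ev e | _ , u<a | _ , a<v , not-last | inj₂ (inj₂ (inj₂ (_ , c))) with next-cases (col v)
      ...   | inj₁ (wrap , _) = not-last wrap
      ...   | inj₂ (_ , nx)   = <-asym (<-trans u<a a<v) (subst (col v <_) (sym (trans c nx)) (n<1+n (col v)))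

      balanced-A : 3 * count (λ v → A v ∧ not (B v)) ≤ 2 * size
      balanced-A = ≤-trans (*-monoʳ-≤ 3 (count-mono {q = λ v → inH v ∧ (col v <ᵇ a)} left-of-a))
                           (proj₁ (proj₂ a-cut))
        where
        left-of-a : ∀ v → A v ∧ not (B v) ≡ true → inH v ∧ (col v <ᵇ a) ≡ true
        left-of-a v e = let (h , v<a) = only-A e in cong₂ _∧_ h (<⇒<ᵇ≡true v<a)

      balanced-B : 3 * count (λ v → B v ∧ not (A v)) ≤ 2 * size
      balanced-B with proj₂ (proj₂ a-cut)
      ... | inj₂ a+2≡m = ≤-trans (≤-reflexive (cong (3 *_) (count-all-false empty))) z≤n
        where
        empty : ∀ v → B v ∧ not (A v) ≡ false
        empty v = ¬-not (λ e → let (_ , a<v , not-last) = only-B e in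
                    <-irrefl a+2≡m (<-≤-trans (+-monoˡ-< 2 a<v)
                      (subst (_≤ m) (+-comm 2 (col v)) (≤∧≢⇒< (col<m v) not-last))))
      ... | inj₁ size≤3L =
        ≤-trans (*-monoʳ-≤ 3 (count-mono {q = λ v → inH v ∧ not (col v <ᵇ suc a)} right)) (two-thirds size≤3L′)
        where
        L R : ℕ
        L = left (suc a)
        R = count (λ v → inH v ∧ not (col v <ᵇ suc a))
        size≡L+R : size ≡ L + R
        size≡L+R = count-split inH (λ v → col v <ᵇ suc a)
        size≤3L′ : L + R ≤ 3 * L
        size≤3L′ = subst (_≤ 3 * L) size≡L+R size≤3L
        right : ∀ v → B v ∧ not (A v) ≡ true → inH v ∧ not (col v <ᵇ suc a) ≡ true
        right v e = let (h , a<v , _) = only-B e in cong₂ _∧_ h (cong not (≥⇒<ᵇ≡false a<v))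
        two-thirds : L + R ≤ 3 * L → 3 * R ≤ 2 * size
        two-thirds h = begin
          3 * R          ≡⟨ solve 1 (λ r → con 3 :* r := r :+ con 2 :* r) refl R ⟩
          R + 2 * R      ≤⟨ +-monoˡ-≤ (2 * R) (+-cancelˡ-≤ L R (2 * L) (subst (L + R ≤_) 3L≡L+2L h)) ⟩
          2 * L + 2 * R  ≡⟨ *-distribˡ-+ 2 L R ⟨
          2 * (L + R)    ≡⟨ cong (2 *_) size≡L+R ⟨
          2 * size       ∎
          where
          open ≤-Reasoning
          3L≡L+2L : 3 * L ≡ L + 2 * L
          3L≡L+2L = solve 1 (λ l → con 3 :* l := l :+ con 2 :* l) refl L

      small-order : count (λ v → A v ∧ B v) ≤ d + d
      small-order = begin
        count (λ v → A v ∧ B v)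
          ≤⟨ count-mono {q = λ v → (col v ≡ᵇ a) ∨ (col v ≡ᵇ m ∸ 1)} two-columns ⟩
        count (λ v → (col v ≡ᵇ a) ∨ (col v ≡ᵇ m ∸ 1))
          ≤⟨ count-∨ (λ v → col v ≡ᵇ a) (λ v → col v ≡ᵇ m ∸ 1) ⟩
        count (λ v → col v ≡ᵇ a) + count (λ v → col v ≡ᵇ m ∸ 1)
          ≤⟨ +-mono-≤ (column-size a) (column-size (m ∸ 1)) ⟩
        d + d ∎
        where
        open ≤-Reasoning
        two-columns : ∀ v → A v ∧ B v ≡ true → (col v ≡ᵇ a) ∨ (col v ≡ᵇ m ∸ 1) ≡ true
        two-columns v e with in-both e
        ... | inj₁ c≡a  = cong (_∨ (col v ≡ᵇ m ∸ 1)) (≡⇒≡ᵇ≡true c≡a)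
        ... | inj₂ last = ∨≡trueʳ (col v ≡ᵇ a) (≡⇒≡ᵇ≡true (cong (_∸ 1) last))

      separation : BalancedSeparation H A B (d + d)
      separation = A∪B , (λ u v eu ev → ¬-not (no-edge u v eu ev ∘ Subgraph.E-adj H u v)) ,
                   balanced-A , balanced-B , small-order

  balanced-separation : AllSubgraphsSeparable G (d + d)
  balanced-separation H = let (a , a-cut) = BalancedCut.cut H in
    BalancedCut.A H a a-cut , BalancedCut.B H a a-cut , BalancedCut.separation H a a-cut

  record Splits (X P Q : V → Bool) : Set where
    field
      cover    : ∀ v → X v ≡ false → P v ≡ false → Q v ≡ true
      disjoint : ∀ v → P v ≡ true → Q v ≡ true → ⊥
      no-edge  : ∀ v w → adjᶜ v w ≡ true → P v ≡ true → Q w ≡ true → ⊥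

  splits-swap : ∀ {X P Q} → Splits X P Q → Splits X Q P
  splits-swap {X} {P} {Q} sp = record
    { cover    = cover′
    ; disjoint = λ v q p → disjoint v p q
    ; no-edge  = λ v w e q p → no-edge w v (adjᶜ-flip e) p q
    }
    where
    open Splits sp
    cover′ : ∀ v → X v ≡ false → Q v ≡ false → P v ≡ true
    cover′ v x q with P v in p
    ... | true  = refl
    ... | false = ⊥-elim (not-¬ (cover v x p) q)

  Closed : (X Z : V → Bool) → Set
  Closed X Z = ∀ {w w′} → Z w ≡ true → adjᶜ w w′ ≡ true → X w′ ≡ false → Z w′ ≡ true

  splits⇒closed : ∀ {X P Q} → Splits X P Q → Closed X P
  splits⇒closed {P = P} sp {w} {w′} pw e x with P w′ in p
  ... | true  = refl
  ... | false = ⊥-elim (Splits.no-edge sp w w′ e pw (Splits.cover sp w′ x p))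

  vertical-step : ∀ {b o} (b<m : b < m) (o<d : o < d) (o+1<d : suc o < d) →
                  Vertical (vertex b o b<m o<d) (vertex b (suc o) b<m o+1<d)
  vertical-step b<m o<d o+1<d = trans (col-vertex b<m o<d) (sym (col-vertex b<m o+1<d)) ,
                                trans (cong suc (row-vertex b<m o<d)) (sym (row-vertex b<m o+1<d))

  horizontal-step : ∀ {b o} (b<m : b < m) (b+1<m : suc b < m) (o<d : o < d) →
                    Horizontal (vertex b o b<m o<d) (vertex (suc b) o b+1<m o<d)
  horizontal-step {b} b<m b+1<m o<d with next-cases b
  ... | inj₁ (wrap , _) = ⊥-elim (<-irrefl wrap b+1<m)
  ... | inj₂ (_ , nx)  = trans (row-vertex b<m o<d) (sym (row-vertex b+1<m o<d)) ,
                         trans (col-vertex b+1<m o<d) (sym (trans (cong next (col-vertex b<m o<d)) nx))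

  wrap-step : ∀ {b o} (b<m : b < m) (0<m : 0 < m) (o<d : o < d) → suc b ≡ m →
              Horizontal (vertex b o b<m o<d) (vertex 0 o 0<m o<d)
  wrap-step {b} b<m 0<m o<d last with next-cases b
  ... | inj₁ (_ , nx)    = trans (row-vertex b<m o<d) (sym (row-vertex 0<m o<d)) ,
                           trans (col-vertex 0<m o<d) (sym (trans (cong next (col-vertex b<m o<d)) nx))
  ... | inj₂ (not-last , _) = ⊥-elim (not-last last)

  vertex-cong : ∀ {b b′ o o′} (b<m : b < m) (b′<m : b′ < m) (o<d : o < d) (o′<d : o′ < d) →
                b ≡ b′ → o ≡ o′ → vertex b o b<m o<d ≡ vertex b′ o′ b′<m o′<d
  vertex-cong _ _ _ _ refl refl = refl

  vertex-toℕ : ∀ (b : Fin m) (o : Fin d) →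
               vertex (toℕ b) (toℕ o) (FP.toℕ<n b) (FP.toℕ<n o) ≡ combine b o
  vertex-toℕ b o = cong₂ combine (FP.fromℕ<-toℕ b (FP.toℕ<n b)) (FP.fromℕ<-toℕ o (FP.toℕ<n o))

  vertex-in-row : ∀ {c} (c<m : c < m) (r : Fin d) →
                  vertex c (toℕ r) c<m (FP.toℕ<n r) ≡ combine (fromℕ< c<m) r
  vertex-in-row c<m r = cong (combine (fromℕ< c<m)) (FP.fromℕ<-toℕ r (FP.toℕ<n r))

  module Spread {X Z : V → Bool} (closed : Closed X Z) where

    module _ {b} (b<m : b < m) (free : ∀ o (o<d : o < d) → X (vertex b o b<m o<d) ≡ false) where

      private
        Z-at : ∀ o → o < d → Set
        Z-at o o<d = Z (vertex b o b<m o<d) ≡ true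

      to-bottom : ∀ o (o<d : o < d) → Z-at o o<d → Z-at 0 (s≤s z≤n)
      to-bottom zero    _     z = z
      to-bottom (suc o) o+1<d z =
        to-bottom o o<d (closed z (adjᶜ-flip (vertical⇒adjᶜ (vertical-step b<m o<d o+1<d))) (free o o<d))
        where o<d = <-trans (n<1+n o) o+1<d

      from-bottom : ∀ o (o<d : o < d) → Z-at 0 (s≤s z≤n) → Z-at o o<d
      from-bottom zero    _     z = z
      from-bottom (suc o) o+1<d z =
        closed (from-bottom o o<d z) (vertical⇒adjᶜ (vertical-step b<m o<d o+1<d)) (free (suc o) o+1<d)
        where o<d = <-trans (n<1+n o) o+1<d

      along-column : ∀ {o o′} (o<d : o < d) (o′<d : o′ < d) → Z-at o o<d → Z-at o′ o′<d
      along-column {o} {o′} o<d o′<d = from-bottom o′ o′<d ∘ to-bottom o o<d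

    column-to-row : ∀ (b : Fin m) (o : Fin d) → (∀ o′ → X (combine b o′) ≡ false) → Z (combine b o) ≡ true →
                    ∀ {r} (r<d : r < d) → Z (vertex (toℕ b) r (FP.toℕ<n b) r<d) ≡ true
    column-to-row b o free z r<d =
      along-column (FP.toℕ<n b) free′ (FP.toℕ<n o) r<d (subst (λ w → Z w ≡ true) (sym (vertex-toℕ b o)) z)
      where
      free′ : ∀ o′ (o′<d : o′ < d) → X (vertex (toℕ b) o′ (FP.toℕ<n b) o′<d) ≡ false
      free′ o′ o′<d =
        trans (cong (λ c → X (combine c (fromℕ< o′<d))) (FP.fromℕ<-toℕ b (FP.toℕ<n b))) (free (fromℕ< o′<d))

    along-row : ∀ {r} (r<d : r < d) {b b′} (b<m : b < m) (b′<m : b′ < m) → b ≤ b′ →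
                (∀ c (c<m : c < m) → b ≤ c → c ≤ b′ → X (vertex c r c<m r<d) ≡ false) →
                Z (vertex b r b<m r<d) ≡ true → Z (vertex b′ r b′<m r<d) ≡ true
    along-row {r} r<d {b} {b′} b<m b′<m b≤b′ free z =
      arrive {c<m = k+b<m} (m∸n+n≡m b≤b′) (walk (b′ ∸ b) k+b<m k+b≤b′)
      where
      k+b≤b′ = ≤-reflexive (m∸n+n≡m b≤b′)
      k+b<m = ≤-<-trans k+b≤b′ b′<m
      walk : ∀ k (k+b<m : k + b < m) → k + b ≤ b′ → Z (vertex (k + b) r k+b<m r<d) ≡ true
      walk zero    _       _       = z
      walk (suc k) k+b+1<m k+b+1≤b′ =
        closed (walk k k+b<m′ (≤-trans (n≤1+n _) k+b+1≤b′))
               (horizontal⇒adjᶜ (horizontal-step k+b<m′ k+b+1<m r<d))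
               (free (suc (k + b)) k+b+1<m (≤-trans (m≤n+m b k) (n≤1+n _)) k+b+1≤b′)
        where k+b<m′ = <-trans (n<1+n (k + b)) k+b+1<m
      arrive : ∀ {c} {c<m : c < m} → c ≡ b′ →
               Z (vertex c r c<m r<d) ≡ true → Z (vertex b′ r b′<m r<d) ≡ true
      arrive refl z = z

  module _ {X P Q : V → Bool} (sp : Splits X P Q) {r} (r<d : r < d) (c₀ : ℕ)
           (only-c₀ : ∀ c (c<m : c < m) → X (vertex c r c<m r<d) ≡ true → c ≡ c₀) where

    private
      open Splits sp
      module P = Spread (splits⇒closed sp)
      module Q = Spread (splits⇒closed (splits-swap sp))

      free : ∀ c (c<m : c < m) → ¬ c ≡ c₀ → X (vertex c r c<m r<d) ≡ false
      free c c<m c≢c₀ = ¬-not (c≢c₀ ∘ only-c₀ c c<m)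

      0<m : 0 < m
      0<m = ≤-trans (s≤s z≤n) 8≤m

      m-1+1 : suc (m ∸ 1) ≡ m
      m-1+1 = m+[n∸m]≡n 0<m

      last<m : m ∸ 1 < m
      last<m = subst (m ∸ 1 <_) m-1+1 (n<1+n (m ∸ 1))

    -- Row r joins P to Q avoiding column c₀, around the cylinder if c₀ lies between b₁ and b₂.
    row-argument : ∀ {b₁ b₂} (b₁<m : b₁ < m) (b₂<m : b₂ < m) → b₁ ≤ b₂ →
                   ¬ b₁ ≡ c₀ → ¬ b₂ ≡ c₀ →
                   P (vertex b₁ r b₁<m r<d) ≡ true → Q (vertex b₂ r b₂<m r<d) ≡ true → ⊥
    row-argument {b₁} {b₂} b₁<m b₂<m b₁≤b₂ b₁≢c₀ b₂≢c₀ p q with b₁ <? c₀ | c₀ <? b₂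
    ... | yes b₁<c₀ | yes c₀<b₂ = disjoint _ p (Q.along-row r<d 0<m b₁<m z≤n free-below q₀)
      where
      free-above : ∀ c (c<m : c < m) → b₂ ≤ c → c ≤ m ∸ 1 → X (vertex c r c<m r<d) ≡ false
      free-above c c<m b₂≤c _ = free c c<m (λ c≡c₀ → <-irrefl (sym c≡c₀) (<-≤-trans c₀<b₂ b₂≤c))
      free-below : ∀ c (c<m : c < m) → 0 ≤ c → c ≤ b₁ → X (vertex c r c<m r<d) ≡ false
      free-below c c<m _ c≤b₁ = free c c<m (λ c≡c₀ → <-irrefl c≡c₀ (≤-<-trans c≤b₁ b₁<c₀))
      q-last : Q (vertex (m ∸ 1) r last<m r<d) ≡ true
      q-last = Q.along-row r<d b₂<m last<m (≤-pred (subst (b₂ <_) (sym m-1+1) b₂<m)) free-above q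
      q₀ : Q (vertex 0 r 0<m r<d) ≡ true
      q₀ = splits⇒closed (splits-swap sp) q-last (horizontal⇒adjᶜ (wrap-step last<m 0<m r<d m-1+1))
                         (free-below 0 0<m z≤n z≤n)
    ... | no b₁≮c₀ | _ = disjoint _ (P.along-row r<d b₁<m b₂<m b₁≤b₂ free-between p) q
      where
      free-between : ∀ c (c<m : c < m) → b₁ ≤ c → c ≤ b₂ → X (vertex c r c<m r<d) ≡ false
      free-between c c<m b₁≤c _ =
        free c c<m (λ c≡c₀ → b₁≮c₀ (≤∧≢⇒< (subst (b₁ ≤_) c≡c₀ b₁≤c) b₁≢c₀))
    ... | yes _ | no c₀≮b₂ = disjoint _ (P.along-row r<d b₁<m b₂<m b₁≤b₂ free-between p) q
      where
      free-between : ∀ c (c<m : c < m) → b₁ ≤ c → c ≤ b₂ → X (vertex c r c<m r<d) ≡ false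
      free-between c c<m _ c≤b₂ =
        free c c<m (λ c≡c₀ → c₀≮b₂ (≤∧≢⇒< (subst (_≤ b₂) c≡c₀ c≤b₂) (b₂≢c₀ ∘ sym)))

  in-row : (V → Bool) → Fin d → ℕ
  in-row Y r = count {m} (λ c → Y (combine c r))

  in-column : (V → Bool) → Fin m → ℕ
  in-column Y b = count {d} (λ o → Y (combine b o))

  count-by-rows : ∀ (X : V → Bool) → count X ≡ sum {d} (in-row X)
  count-by-rows X = begin
    count X
      ≡⟨ count-combine {m} {d} X ⟩
    sum {m} (λ c → count {d} (λ r → X (combine c r)))
      ≡⟨ sum-cong-≗ {m} (λ c → count≡∑𝟙 {d} (λ r → X (combine c r))) ⟩
    sum {m} (λ c → sum {d} (λ r → 𝟙 (X (combine c r))))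
      ≡⟨ ∑-comm {m} {d} (λ c r → 𝟙 (X (combine c r))) ⟩
    sum {d} (λ r → sum {m} (λ c → 𝟙 (X (combine c r))))
      ≡⟨ sum-cong-≗ {d} (λ r → count≡∑𝟙 {m} (λ c → X (combine c r))) ⟨
    sum {d} (λ r → count {m} (λ c → X (combine c r))) ∎
    where open ≡-Reasoning

  -- Row r meets X at most in column c₀; c₀ = m, a column that does not exist, if X misses the row.
  SparseRow : (V → Bool) → Set
  SparseRow X = ∃ λ (r : Fin d) → ∃ λ c₀ →
    (∀ c (c<m : c < m) → X (vertex c (toℕ r) c<m (FP.toℕ<n r)) ≡ true → c ≡ c₀) ×
    (∀ c (c<m : c < m) → X (vertex c (toℕ r) c<m (FP.toℕ<n r)) ≡ false → ¬ c ≡ c₀)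

  sparse-row : ∀ {X} → count X < d + d → SparseRow X
  sparse-row {X} small with search (λ r → in-row X r <ᵇ 2)
  ... | inj₂ dense = ⊥-elim (<⇒≱ small (begin
    d + d                                             ≡⟨ solve 1 (λ d → d :+ d := d :* con 2) refl d ⟩
    d * 2                                             ≡⟨ sum-const d 2 ⟨
    sum {d} (λ _ → 2)                                 ≤⟨ sum-mono-≤ (λ r → <ᵇ≡false⇒≥ (in-row X r) 2 (dense r)) ⟩
    sum {d} (in-row X)                                ≡⟨ count-by-rows X ⟨
    count X                                           ∎))
    where open ≤-Reasoning
  ... | inj₁ (r , sparse) with search (λ (c : Fin m) → X (combine c r))
  ...   | inj₂ none =
    r , m , (λ c c<m x → ⊥-elim (not-¬ (trans (cong X (sym (vertex-in-row c<m r))) x) (none (fromℕ< c<m))))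
          , (λ c c<m _ → <⇒≢ c<m)
  ...   | inj₁ (c₁ , x₁) = r , toℕ c₁ , only , (λ c c<m x c≡c₁ → not-¬ (on-c₁ c<m c≡c₁) x)
    where
    only : ∀ c (c<m : c < m) → X (vertex c (toℕ r) c<m (FP.toℕ<n r)) ≡ true → c ≡ toℕ c₁
    only c c<m x = trans (sym (FP.toℕ-fromℕ< c<m))
                         (cong toℕ (count-≤1⇒unique (≤-pred (<ᵇ≡true⇒< _ 2 sparse))
                                                      (trans (cong X (sym (vertex-in-row c<m r))) x) x₁))
    on-c₁ : ∀ {c} (c<m : c < m) → c ≡ toℕ c₁ → X (vertex c (toℕ r) c<m (FP.toℕ<n r)) ≡ true
    on-c₁ c<m c≡c₁ =
      trans (cong X (trans (vertex-cong c<m (FP.toℕ<n c₁) (FP.toℕ<n r) (FP.toℕ<n r) c≡c₁ refl)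
                           (vertex-toℕ c₁ r)))
            x₁

  FreeColumn : (X Z : V → Bool) → Set
  FreeColumn X Z =
    ∃ λ (b : Fin m) → ∃ λ (o : Fin d) → Z (combine b o) ≡ true × (∀ o′ → X (combine b o′) ≡ false)

  -- The columns meeting X hold at most d * count X < T vertices.
  free-column : ∀ {X Z} → count X < d + d → T ≤ count Z → FreeColumn X Z
  free-column {X} {Z} small big with search (λ b → (in-column X b ≡ᵇ 0) ∧ (0 <ᵇ in-column Z b))
  ... | inj₁ (b , e) =
    let (o , z) = count>0⇒∃ (λ o → Z (combine b o)) (<ᵇ≡true⇒< 0 _ (∧-conicalʳ (in-column X b ≡ᵇ 0) _ e))
    in b , o , z , count≡0⇒false (≡ᵇ≡true⇒≡ _ 0 (∧-conicalˡ _ _ e))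
  ... | inj₂ none = ⊥-elim (<⇒≱ (<-≤-trans (*-monoʳ-< d small) (≤-reflexive d[d+d]≡T)) (≤-trans big Z≤dX))
    where
    d[d+d]≡T : d * (d + d) ≡ T
    d[d+d]≡T = solve 1 (λ d → d :* (d :+ d) := con 2 :* d :* d) refl d
    Z≤dX : count Z ≤ d * count X
    Z≤dX = begin
      count Z                             ≡⟨ count-combine {m} {d} Z ⟩
      sum {m} (in-column Z)               ≤⟨ sum-mono-≤ per-column ⟩
      sum {m} (λ b → d * in-column X b)   ≡⟨ sum-*ˡ d (in-column X) ⟩
      d * sum {m} (in-column X)           ≡⟨ cong (d *_) (count-combine {m} {d} X) ⟨
      d * count X                         ∎
      where
      open ≤-Reasoning
      per-column : ∀ b → in-column Z b ≤ d * in-column X b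
      per-column b with in-column X b in e
      ... | zero  = ≤-trans (<ᵇ≡false⇒≥ 0 _ no-Z) (≤-reflexive (sym (*-zeroʳ d)))
        where no-Z = subst (λ k → (k ≡ᵇ 0) ∧ (0 <ᵇ in-column Z b) ≡ false) e (none b)
      ... | suc k = ≤-trans (count≤n (λ o → Z (combine b o)))
                            (≤-trans (≤-reflexive (sym (*-identityʳ d))) (*-monoʳ-≤ d (s≤s z≤n)))

  free-columns-meet : ∀ {X P Q} → Splits X P Q → SparseRow X → FreeColumn X P → FreeColumn X Q → ⊥
  free-columns-meet {X} sp (r , c₀ , only-c₀ , off-c₀) (b₁ , o₁ , p , free₁) (b₂ , o₂ , q , free₂) =
    [ (λ b₁≤b₂ → row-argument sp r<d c₀ only-c₀ (FP.toℕ<n b₁) (FP.toℕ<n b₂) b₁≤b₂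
                              (off b₁ free₁) (off b₂ free₂) p′ q′)
    , (λ b₂≤b₁ → row-argument (splits-swap sp) r<d c₀ only-c₀ (FP.toℕ<n b₂) (FP.toℕ<n b₁) b₂≤b₁
                              (off b₂ free₂) (off b₁ free₁) q′ p′)
    ] (≤-total (toℕ b₁) (toℕ b₂))
    where
    r<d = FP.toℕ<n r
    off : ∀ b → (∀ o → X (combine b o) ≡ false) → ¬ toℕ b ≡ c₀
    off b free = off-c₀ (toℕ b) (FP.toℕ<n b) (trans (cong X (vertex-toℕ b r)) (free r))
    p′ = Spread.column-to-row (splits⇒closed sp) b₁ o₁ free₁ p r<d
    q′ = Spread.column-to-row (splits⇒closed (splits-swap sp)) b₂ o₂ free₂ q r<d

  no-small-separator : ∀ {X P Q} → Splits X P Q → count X < d + d → T ≤ count P → T ≤ count Q → ⊥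
  no-small-separator sp small bigP bigQ =
    free-columns-meet sp (sparse-row small) (free-column small bigP) (free-column small bigQ)

  -- sn ≥ 2d

  3[2d+T]≤N : 3 * (d + d + T) ≤ N
  3[2d+T]≤N = begin
    3 * (d + d + T)   ≤⟨ m≤m+n (3 * (d + d + T)) (5 * T + 10 * d + 8) ⟩
    3 * (d + d + T) + (5 * T + 10 * d + 8)
                      ≡⟨ solve 2 (λ d t → con 3 :* (d :+ d :+ t) :+ (con 5 :* t :+ con 10 :* d :+ con 8)
                                       := con 8 :* (t :+ con 2 :* d) :+ con 8) refl d T ⟩
    8 * s + 8         ≡⟨ m≡8s+8 ⟨
    m                 ≤⟨ m≤m*n m d ⟩
    N                 ∎
    where open ≤-Reasoning

  balanced⇒large : ∀ {x p q} → x < d + d → 3 * (d + d + T) ≤ x + p + q →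
                   3 * p ≤ 2 * (x + p + q) → 3 * q ≤ 2 * (x + p + q) → T ≤ p × T ≤ q
  balanced⇒large {x} {p} {q} x<2d big balanced-p balanced-q =
    one-side big balanced-q ,
    one-side (subst (3 * (d + d + T) ≤_) swap big) (subst (λ n → 3 * p ≤ 2 * n) swap balanced-p)
    where
    swap : x + p + q ≡ x + q + p
    swap = solve 3 (λ x p q → x :+ p :+ q := x :+ q :+ p) refl x p q
    one-side : ∀ {p q} → 3 * (d + d + T) ≤ x + p + q → 3 * q ≤ 2 * (x + p + q) → T ≤ p
    one-side {p} {q} big balanced with p <? T
    ... | no  p≮T = ≮⇒≥ p≮T
    ... | yes p<T = ⊥-elim (<-irrefl refl (begin-strict
      x + p + q        ≤⟨ n≤3[x+p] ⟩
      3 * (x + p)      <⟨ *-monoʳ-< 3 (+-mono-< x<2d p<T) ⟩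
      3 * (d + d + T)  ≤⟨ big ⟩
      x + p + q        ∎))
      where
      open ≤-Reasoning
      n≤3[x+p] : x + p + q ≤ 3 * (x + p)
      n≤3[x+p] = +-cancelʳ-≤ (2 * (x + p + q)) (x + p + q) (3 * (x + p)) (begin
        x + p + q + 2 * (x + p + q)    ≡⟨ solve 3 (λ x p q → x :+ p :+ q :+ con 2 :* (x :+ p :+ q)
                                                        := con 3 :* (x :+ p) :+ con 3 :* q) refl x p q ⟩
        3 * (x + p) + 3 * q            ≤⟨ +-monoʳ-≤ (3 * (x + p)) balanced ⟩
        3 * (x + p) + 2 * (x + p + q)  ∎)

  whole : Subgraph G
  whole = record { S = λ _ → true ; E = adjᶜ ; E-sym = adjᶜ-sym ; E-adj = λ _ _ e → e ; E-S = λ _ _ _ → refl }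

  no-small-separation : ∀ j → j < d + d → ¬ AllSubgraphsSeparable G j
  no-small-separation j j<2d separable with separable whole
  ... | A , B , A∪B , separated , balanced-P , balanced-Q , order =
    no-small-separator splits small (proj₁ large) (proj₂ large)
    where
    X P Q : V → Bool
    X v = A v ∧ B v
    P v = A v ∧ not (B v)
    Q v = B v ∧ not (A v)
    small : count X < d + d
    small = ≤-<-trans order j<2d
    splits : Splits X P Q
    splits = record
      { cover    = λ v x p → cover (A v) (B v) (A∪B v) x p
      ; disjoint = λ v p q → not-¬ (∧-conicalˡ (A v) _ p) (not-injective (∧-conicalʳ (B v) _ q))
      ; no-edge  = λ v w e p q → not-¬ e (separated v w p q)
      }
      where
      cover : ∀ a b → a ∨ b ≡ true → a ∧ b ≡ false → a ∧ not b ≡ false → b ∧ not a ≡ true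
      cover false true  _ _ _ = refl
      cover true  true  _ () _
      cover true  false _ _ ()
    partition : count (Subgraph.S whole) ≡ count X + count P + count Q
    partition = begin
      count {N} (λ _ → true)              ≡⟨ count-split (λ _ → true) A ⟩
      count A + count (not ∘ A)           ≡⟨ cong₂ _+_ (count-split A B) (count-cong only-B) ⟩
      count X + count P + count Q         ∎
      where
      open ≡-Reasoning
      only-B : ∀ v → not (A v) ≡ Q v
      only-B v with A v | B v | A∪B v
      ... | true  | b    | _ = sym (∧-zeroʳ b)
      ... | false | true | _ = refl
    large : T ≤ count P × T ≤ count Q
    large = balanced⇒large small
      (subst (3 * (d + d + T) ≤_) (trans (sym (count-all-true {N} (λ _ → refl))) partition) 3[2d+T]≤N)
      (subst (λ n → 3 * count P ≤ 2 * n) partition balanced-P)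
      (subst (λ n → 3 * count Q ≤ 2 * n) partition balanced-Q)

  -- lcr° ≥ 2d′

  module Drawing (pos : V → V) (pos-injective : Injective _≡_ _≡_ pos) where

    π : V → ℕ
    π = toℕ ∘ pos

    π-injective : ∀ {x y} → π x ≡ π y → x ≡ y
    π-injective = pos-injective ∘ FP.toℕ-injective

    π<N : ∀ x → π x < N
    π<N = FP.toℕ<n ∘ pos

    at-position : ∀ g → count (λ x → π x ≡ᵇ g) ≤ 1
    at-position g =
      count-≤1 _ (λ x y ex ey → π-injective (trans (≡ᵇ≡true⇒≡ _ g ex) (sym (≡ᵇ≡true⇒≡ _ g ey))))

    count-positions : ∀ (q : ℕ → Bool) → count {N} (q ∘ toℕ) ≤ count (q ∘ π)
    count-positions q = count-preimage pos-injective (q ∘ toℕ)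

    -- Deleting the points g₁ and g₂ and the inner ends of the edges across the chord g₁g₂ separates
    -- the other inner vertices from the outer ones.
    module Chord {g₁ g₂} (g₁<g₂ : g₁ < g₂) (g₂<N : g₂ < N) where

      inner outer : V → Bool
      inner x = (g₁ <ᵇ π x) ∧ (π x <ᵇ g₂)
      outer x = (π x <ᵇ g₁) ∨ (g₂ <ᵇ π x)

      across : V → V → Bool
      across x y = adjᶜ x y ∧ ((inner x ∧ outer y) ∨ (outer x ∧ inner y))

      reaches-out : V → Bool
      reaches-out x = 0 <ᵇ count (λ y → adjᶜ x y ∧ outer y)

      exposed sheltered separator : V → Bool
      exposed   x = inner x ∧ reaches-out x
      sheltered x = inner x ∧ not (reaches-out x)
      separator x = (π x ≡ᵇ g₁) ∨ ((π x ≡ᵇ g₂) ∨ exposed x)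

      inner-sound : ∀ {x} → inner x ≡ true → g₁ < π x × π x < g₂
      inner-sound {x} e =
        <ᵇ≡true⇒< g₁ (π x) (∧-conicalˡ _ _ e) , <ᵇ≡true⇒< (π x) g₂ (∧-conicalʳ (g₁ <ᵇ π x) _ e)

      outer-sound : ∀ {x} → outer x ≡ true → π x < g₁ ⊎ g₂ < π x
      outer-sound {x} e with ∨≡true⇒⊎ {π x <ᵇ g₁} e
      ... | inj₁ below = inj₁ (<ᵇ≡true⇒< (π x) g₁ below)
      ... | inj₂ above = inj₂ (<ᵇ≡true⇒< g₂ (π x) above)

      inner-outer-disjoint : ∀ {x} → inner x ≡ true → outer x ≡ true → ⊥
      inner-outer-disjoint i o with inner-sound i | outer-sound o
      ... | g₁<x , _ | inj₁ x<g₁ = <-asym g₁<x x<g₁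
      ... | _ , x<g₂ | inj₂ g₂<x = <-asym x<g₂ g₂<x

      outer⇒not-inner : ∀ {x} → outer x ≡ true → inner x ≡ false
      outer⇒not-inner o = ¬-not (λ i → inner-outer-disjoint i o)

      across-sym : ∀ x y → across x y ≡ across y x
      across-sym x y = cong₂ _∧_ (adjᶜ-sym x y)
        (trans (∨-comm (inner x ∧ outer y) (outer x ∧ inner y))
               (cong₂ _∨_ (∧-comm (outer x) (inner y)) (∧-comm (inner x) (outer y))))

      across-separates : ∀ x y → across x y ≡ true → inner x xor inner y ≡ true
      across-separates x y e with ∨≡true⇒⊎ {inner x ∧ outer y} (∧-conicalʳ (adjᶜ x y) _ e)
      ... | inj₁ io = subst (λ z → z xor inner y ≡ true) (sym (∧-conicalˡ (inner x) _ io))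
                            (cong not (outer⇒not-inner (∧-conicalʳ (inner x) _ io)))
      ... | inj₂ oi = subst (λ z → z xor inner y ≡ true)
                            (sym (outer⇒not-inner (∧-conicalˡ (outer x) _ oi))) (∧-conicalʳ (outer x) _ oi)

      across-sound : ∀ {x y} → across x y ≡ true →
                     adjᶜ x y ≡ true × (inner x ≡ true × outer y ≡ true ⊎ outer x ≡ true × inner y ≡ true)
      across-sound {x} {y} a with ∨≡true⇒⊎ {inner x ∧ outer y} (∧-conicalʳ (adjᶜ x y) _ a)
      ... | inj₁ io = ∧-conicalˡ (adjᶜ x y) _ a ,
                      inj₁ (∧-conicalˡ (inner x) _ io , ∧-conicalʳ (inner x) _ io)
      ... | inj₂ oi = ∧-conicalˡ (adjᶜ x y) _ a ,
                      inj₂ (∧-conicalˡ (outer x) _ oi , ∧-conicalʳ (outer x) _ oi)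

      count-exposed : count exposed ≤ countPairs across
      count-exposed = begin
        count exposed
          ≡⟨ count≡∑𝟙 exposed ⟩
        sum (𝟙 ∘ exposed)
          ≤⟨ sum-mono-≤ one-edge ⟩
        sum (λ x → count (λ y → inner x ∧ across x y))
          ≡⟨ countPairs-across inner across across-sym across-separates ⟨
        countPairs across ∎
        where
        open ≤-Reasoning
        one-edge : ∀ x → 𝟙 (exposed x) ≤ count (λ y → inner x ∧ across x y)
        one-edge x with exposed x in e
        ... | false = z≤n
        ... | true  =
          let i = ∧-conicalˡ (inner x) _ e
              (y , ey) = count>0⇒∃ (λ y → adjᶜ x y ∧ outer y) (<ᵇ≡true⇒< 0 _ (∧-conicalʳ (inner x) _ e))
              io = cong₂ _∧_ i (∧-conicalʳ (adjᶜ x y) _ ey)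
          in count-≥1 y (cong₂ _∧_ i (cong₂ _∧_ (∧-conicalˡ (adjᶜ x y) _ ey)
                                                (cong (_∨ (outer x ∧ inner y)) io)))

      splits : Splits separator sheltered outer
      splits = record { cover = cover ; disjoint = disjoint ; no-edge = no-edge }
        where
        cover : ∀ v → separator v ≡ false → sheltered v ≡ false → outer v ≡ true
        cover v not-sep not-shel with <-cmp (π v) g₁
        ... | tri< v<g₁ _ _ = cong (_∨ (g₂ <ᵇ π v)) (<⇒<ᵇ≡true v<g₁)
        ... | tri≈ _ v≡g₁ _ =
          ⊥-elim (not-¬ (cong (_∨ ((π v ≡ᵇ g₂) ∨ exposed v)) (≡⇒≡ᵇ≡true v≡g₁)) not-sep)
        ... | tri> _ _ g₁<v with <-cmp (π v) g₂
        ...   | tri> _ _ g₂<v = ∨≡trueʳ (π v <ᵇ g₁) (<⇒<ᵇ≡true g₂<v)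
        ...   | tri≈ _ v≡g₂ _ =
          ⊥-elim (not-¬ (∨≡trueʳ (π v ≡ᵇ g₁) (cong (_∨ exposed v) (≡⇒≡ᵇ≡true v≡g₂))) not-sep)
        ...   | tri< v<g₂ _ _ = ⊥-elim (not-¬ (cong₂ _∧_ inside (cong not stays-in)) not-shel)
          where
          inside : inner v ≡ true
          inside = cong₂ _∧_ (<⇒<ᵇ≡true g₁<v) (<⇒<ᵇ≡true v<g₂)
          stays-in : reaches-out v ≡ false
          stays-in = subst (λ z → z ∧ reaches-out v ≡ false) inside
                           (∨-conicalʳ (π v ≡ᵇ g₂) _ (∨-conicalʳ (π v ≡ᵇ g₁) _ not-sep))
        disjoint : ∀ v → sheltered v ≡ true → outer v ≡ true → ⊥
        disjoint v s = inner-outer-disjoint (∧-conicalˡ (inner v) _ s)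
        no-edge : ∀ v w → adjᶜ v w ≡ true → sheltered v ≡ true → outer w ≡ true → ⊥
        no-edge v w e s o =
          not-¬ (<⇒<ᵇ≡true (count-≥1 w (cong₂ _∧_ e o))) (not-injective (∧-conicalʳ (inner v) _ s))

      count-separator : count separator ≤ 2 + countPairs across
      count-separator = begin
        count separator
          ≤⟨ count-∨ (λ x → π x ≡ᵇ g₁) (λ x → (π x ≡ᵇ g₂) ∨ exposed x) ⟩
        count (λ x → π x ≡ᵇ g₁) + count (λ x → (π x ≡ᵇ g₂) ∨ exposed x)
          ≤⟨ +-mono-≤ (at-position g₁) (count-∨ (λ x → π x ≡ᵇ g₂) exposed) ⟩
        1 + (count (λ x → π x ≡ᵇ g₂) + count exposed)
          ≤⟨ +-monoʳ-≤ 1 (+-mono-≤ (at-position g₂) count-exposed) ⟩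
        2 + countPairs across ∎
        where open ≤-Reasoning

      count-sheltered : g₂ ≤ countPairs across + count sheltered + suc g₁
      count-sheltered = begin
        g₂
          ≡⟨ count-between g₁ g₂ g₁<g₂ (<⇒≤ g₂<N) ⟨
        count {N} (λ i → (g₁ <ᵇ toℕ i) ∧ (toℕ i <ᵇ g₂)) + suc g₁
          ≤⟨ +-monoˡ-≤ (suc g₁) (count-positions (λ p → (g₁ <ᵇ p) ∧ (p <ᵇ g₂))) ⟩
        count inner + suc g₁
          ≡⟨ cong (_+ suc g₁) (count-split inner reaches-out) ⟩
        count exposed + count sheltered + suc g₁
          ≤⟨ +-monoˡ-≤ (suc g₁) (+-monoˡ-≤ (count sheltered) count-exposed) ⟩
        countPairs across + count sheltered + suc g₁ ∎
        where open ≤-Reasoning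

      count-outer : g₁ + N ≤ count outer + suc g₂
      count-outer = begin
        g₁ + N
          ≡⟨ cong (g₁ +_) (count-> g₂ g₂<N) ⟨
        g₁ + (count {N} (λ i → g₂ <ᵇ toℕ i) + suc g₂)
          ≡⟨ +-assoc g₁ _ (suc g₂) ⟨
        g₁ + count {N} (λ i → g₂ <ᵇ toℕ i) + suc g₂
          ≤⟨ +-monoˡ-≤ (suc g₂) (+-mono-≤ below above) ⟩
        count (λ x → π x <ᵇ g₁) + count (λ x → g₂ <ᵇ π x) + suc g₂
          ≡⟨ cong (_+ suc g₂) (count-∨-disjoint (λ x → π x <ᵇ g₁) (λ x → g₂ <ᵇ π x) apart) ⟨
        count outer + suc g₂ ∎
        where
        open ≤-Reasoning
        below : g₁ ≤ count (λ x → π x <ᵇ g₁)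
        below = ≤-trans (≤-reflexive (sym (count-< g₁ (<⇒≤ (<-trans g₁<g₂ g₂<N)))))
                        (count-positions (_<ᵇ g₁))
        above : count {N} (λ i → g₂ <ᵇ toℕ i) ≤ count (λ x → g₂ <ᵇ π x)
        above = count-positions (g₂ <ᵇ_)
        apart : ∀ x → (π x <ᵇ g₁) ≡ true → (g₂ <ᵇ π x) ≡ true → ⊥
        apart x x<g₁ g₂<x = <-asym (<-trans (<ᵇ≡true⇒< _ g₁ x<g₁) g₁<g₂) (<ᵇ≡true⇒< g₂ _ g₂<x)

      chord-lemma : countPairs across + 3 ≤ d + d → T + countPairs across + suc g₁ ≤ g₂ →
                    T + suc g₂ ≤ g₁ + N → ⊥
      chord-lemma few-across inside-big outside-big = no-small-separator splits small
        (+-cancelʳ-≤ (cp + suc g₁) T (count sheltered) (begin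
          T + (cp + suc g₁)                ≡⟨ +-assoc T _ _ ⟨
          T + cp + suc g₁                  ≤⟨ inside-big ⟩
          g₂                               ≤⟨ count-sheltered ⟩
          cp + count sheltered + suc g₁    ≡⟨ solve 3 (λ c s g → c :+ s :+ g := s :+ (c :+ g))
                                                       refl cp (count sheltered) (suc g₁) ⟩
          count sheltered + (cp + suc g₁)  ∎))
        (+-cancelʳ-≤ (suc g₂) T (count outer) (≤-trans outside-big count-outer))
        where
        open ≤-Reasoning
        cp = countPairs across
        small : count separator < d + d
        small = ≤-<-trans count-separator (subst (_≤ d + d) (+-comm cp 3) few-across)

    module _ (j : ℕ) (j+3≤2d : j + 3 ≤ d + d)
             (planar : ∀ u v → adjᶜ u v ≡ true → crossings G pos u v ≤ j) where

      s>0 : 0 < s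
      s>0 = ≤-trans (s≤s z≤n) (m≤n+m (2 * d) T)

      T<s : T < s
      T<s = m<m+n T (≤-trans (s≤s z≤n) (m≤m+n d (d + 0)))

      d≥2 : 2 ≤ d
      d≥2 = ≮⇒≥ (λ d<2 → ≤⇒≯ (+-mono-≤ (≤-pred d<2) (≤-pred d<2)) (≤-trans (m≤n+m 3 j) j+3≤2d))

      j+1≤2d : j + 1 ≤ d + d
      j+1≤2d = ≤-trans (+-monoʳ-≤ j (s≤s z≤n)) j+3≤2d

      long-edge : ∀ u v → adjᶜ u v ≡ true → π u + s ≤ π v → π v + s ≤ π u + N → ⊥
      long-edge u v e near far = chord-lemma (≤-trans (+-monoˡ-≤ 3 few) j+3≤2d) inside outside
        where
        u<v : π u < π v
        u<v = <-≤-trans (m<m+n (π u) s>0) near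
        open Chord u<v (π<N v)
        across⇒crossing : ∀ x y → across x y ≡ true → crossingᵇ π (π u) (π v) x y ≡ true
        across⇒crossing x y a with across-sound a
        ... | e , inj₁ (i , o) = cong₂ _∧_ e
          (let (u<x , x<v) = inner-sound i in crossᵇ-inside-outside u<x x<v (outer-sound o))
        ... | e , inj₂ (o , i) = cong₂ _∧_ e
          (let (u<y , y<v) = inner-sound i
           in trans (crossᵇ-swapʳ (π u) (π v) (π x) (π y)) (crossᵇ-inside-outside u<y y<v (outer-sound o)))
        few : countPairs across ≤ j
        few = ≤-trans (countPairs-mono across⇒crossing) (planar u v e)
        inside : T + countPairs across + suc (π u) ≤ π v
        inside = begin
          T + countPairs across + suc (π u)  ≤⟨ +-monoˡ-≤ (suc (π u)) (+-monoʳ-≤ T few) ⟩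
          T + j + suc (π u)                  ≡⟨ solve 3 (λ t j a → t :+ j :+ (con 1 :+ a) := a :+ (t :+ (j :+ con 1)))
                                                        refl T j (π u) ⟩
          π u + (T + (j + 1))                ≤⟨ +-monoʳ-≤ (π u) (+-monoʳ-≤ T j+1≤2d) ⟩
          π u + (T + (d + d))                ≡⟨ cong (λ z → π u + (T + (d + z))) (+-identityʳ d) ⟨
          π u + s                            ≤⟨ near ⟩
          π v                                ∎
          where open ≤-Reasoning
        outside : T + suc (π v) ≤ π u + N
        outside = begin
          T + suc (π v)  ≡⟨ solve 2 (λ t b → t :+ (con 1 :+ b) := b :+ (con 1 :+ t)) refl T (π v) ⟩
          π v + suc T    ≤⟨ +-monoʳ-≤ (π v) T<s ⟩
          π v + s        ≤⟨ far ⟩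
          π u + N        ∎
          where open ≤-Reasoning

      covers : ℕ → V → V → Bool
      covers g x y = adjᶜ x y ∧ ((π x <ᵇ g) ∧ ((g <ᵇ π y) ∧ (π y <ᵇ π x + s)))

      covering : ℕ → V → V → Bool
      covering g x y = covers g x y ∨ covers g y x

      record Covers (g : ℕ) (x y : V) : Set where
        field
          edge  : adjᶜ x y ≡ true
          x<g   : π x < g
          g<y   : g < π y
          y<x+s : π y < π x + s

      covers-sound : ∀ {g x y} → covers g x y ≡ true → Covers g x y
      covers-sound {g} {x} {y} e = record
        { edge  = ∧-conicalˡ (adjᶜ x y) _ e
        ; x<g   = <ᵇ≡true⇒< _ g (∧-conicalˡ (π x <ᵇ g) _ rest)
        ; g<y   = <ᵇ≡true⇒< g _ (∧-conicalˡ (g <ᵇ π y) _ rest′)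
        ; y<x+s = <ᵇ≡true⇒< _ _ (∧-conicalʳ (g <ᵇ π y) _ rest′)
        }
        where
        rest  = ∧-conicalʳ (adjᶜ x y) _ e
        rest′ = ∧-conicalʳ (π x <ᵇ g) _ rest

      covers-complete : ∀ {g x y} → Covers g x y → covers g x y ≡ true
      covers-complete c =
        cong₂ _∧_ edge (cong₂ _∧_ (<⇒<ᵇ≡true x<g) (cong₂ _∧_ (<⇒<ᵇ≡true g<y) (<⇒<ᵇ≡true y<x+s)))
        where open Covers c

      -- The covering edges of the end points of a longest edge uv covering c all cross uv.
      module Longest {c u v} (uv : Covers c u v)
                     (longest : ∀ x y → covers c x y ≡ true → π y ∸ π x ≤ π v ∸ π u) where

        open Covers uv using () renaming (x<g to u<c; g<y to c<v; edge to uv-edge)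

        shorter : ∀ {x y} → Covers c x y → π y + π u ≤ π v + π x
        shorter {x} {y} xy = begin
          π y + π u                 ≡⟨ cong (_+ π u) (m∸n+n≡m x≤y) ⟨
          π y ∸ π x + π x + π u     ≡⟨ +-assoc (π y ∸ π x) (π x) (π u) ⟩
          π y ∸ π x + (π x + π u)   ≡⟨ cong (π y ∸ π x +_) (+-comm (π x) (π u)) ⟩
          π y ∸ π x + (π u + π x)   ≡⟨ +-assoc (π y ∸ π x) (π u) (π x) ⟨
          π y ∸ π x + π u + π x     ≤⟨ +-monoˡ-≤ (π x) (+-monoˡ-≤ (π u) (longest x y (covers-complete xy))) ⟩
          π v ∸ π u + π u + π x     ≡⟨ cong (_+ π x) (m∸n+n≡m (<⇒≤ (<-trans u<c c<v))) ⟩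
          π v + π x                 ∎
          where
          open ≤-Reasoning
          x≤y = <⇒≤ (<-trans (Covers.x<g xy) (Covers.g<y xy))

        starts-before-v : ∀ {x y} → Covers (π u) x y → π x < π v
        starts-before-v xy = <-trans (Covers.x<g xy) (<-trans u<c c<v)

        ends-before-v : ∀ {x y} → Covers (π u) x y → π y < π v
        ends-before-v {x} {y} xy = ≰⇒> (λ v≤y → <⇒≱ (+-mono-≤-< v≤y x<g) (shorter record
          { edge = edge ; x<g = <-trans x<g u<c ; g<y = <-≤-trans c<v v≤y ; y<x+s = y<x+s }))
          where open Covers xy

        starts-after-u : ∀ {x y} → Covers (π v) x y → π u < π x
        starts-after-u {x} {y} xy = ≰⇒> (λ x≤u → <⇒≱ (+-mono-<-≤ g<y x≤u) (shorter record
          { edge = edge ; x<g = ≤-<-trans x≤u u<c ; g<y = <-trans c<v g<y ; y<x+s = y<x+s }))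
          where open Covers xy

        crosses-at-u : ∀ {x y} → Covers (π u) x y → crossingᵇ π (π u) (π v) x y ≡ true
        crosses-at-u {x} {y} xy = cong₂ _∧_ edge (trans (crossᵇ-swapʳ (π u) (π v) (π x) (π y))
                                                        (crossᵇ-inside-outside g<y (ends-before-v xy) (inj₁ x<g)))
          where open Covers xy

        crosses-at-v : ∀ {x y} → Covers (π v) x y → crossingᵇ π (π u) (π v) x y ≡ true
        crosses-at-v {x} {y} xy = cong₂ _∧_ edge (crossᵇ-inside-outside (starts-after-u xy) x<g (inj₂ g<y))
          where open Covers xy

        covering⇒crossing : ∀ {g} →
                            (∀ {x y} → Covers g x y → crossingᵇ π (π u) (π v) x y ≡ true) →
                            ∀ x y → covering g x y ≡ true → crossingᵇ π (π u) (π v) x y ≡ true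
        covering⇒crossing crosses x y e with ∨≡true⇒⊎ e
        ... | inj₁ xy = crosses (covers-sound xy)
        ... | inj₂ yx = trans (crossingᵇ-sym π (π u) (π v) x y) (crosses (covers-sound yx))

        not-both : ∀ x y → covering (π u) x y ≡ true → covering (π v) x y ≡ true → ⊥
        not-both x y at-u at-v with ∨≡true⇒⊎ {covers (π u) x y} at-u | ∨≡true⇒⊎ {covers (π v) x y} at-v
        ... | inj₁ xy | inj₁ xy′ = <-asym (ends-before-v (covers-sound xy)) (Covers.g<y (covers-sound xy′))
        ... | inj₁ xy | inj₂ yx′ = <-asym (starts-before-v (covers-sound xy)) (Covers.g<y (covers-sound yx′))
        ... | inj₂ yx | inj₁ xy′ = <-asym (starts-before-v (covers-sound yx)) (Covers.g<y (covers-sound xy′))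
        ... | inj₂ yx | inj₂ yx′ = <-asym (ends-before-v (covers-sound yx)) (Covers.g<y (covers-sound yx′))

        few-covering : countPairs (covering (π u)) + countPairs (covering (π v)) ≤ j
        few-covering =
          ≤-trans (countPairs-disjoint not-both (covering⇒crossing crosses-at-u) (covering⇒crossing crosses-at-v))
                  (planar u v uv-edge)

      cut-point : ∀ c → ∃ λ g → c < g + s × g < c + s × countPairs (covering g) + 2 ≤ d
      cut-point c with search₂ (covers c)
      ... | inj₂ none = c , m<m+n c s>0 , m<m+n c s>0 ,
                        subst (λ k → k + 2 ≤ d) (sym (countPairs-none (λ x y → cong₂ _∨_ (none x y) (none y x))))
                              d≥2
      ... | inj₁ w with argmax₂ (covers c) (λ x y → π y ∸ π x) w
      ...   | u , v , e , longest with countPairs (covering (π u)) + 2 ≤? d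
      ...     | yes few = π u , <-trans c<v v<u+s , <-≤-trans u<c (m≤m+n c s) , few
        where open Covers (covers-sound {c} e) renaming (x<g to u<c; g<y to c<v; y<x+s to v<u+s)
      ...     | no  many = π v , <-≤-trans c<v (m≤m+n (π v) s) , <-trans v<u+s (+-monoˡ-< s u<c) , few-at-v
        where
        open Covers (covers-sound {c} e) renaming (x<g to u<c; g<y to c<v; y<x+s to v<u+s)
        A B : ℕ
        A = countPairs (covering (π u))
        B = countPairs (covering (π v))
        few-at-v : B + 2 ≤ d
        few-at-v = +-cancelʳ-≤ d (B + 2) d (begin
          B + 2 + d          ≤⟨ +-monoʳ-≤ (B + 2) (≤-pred (subst (suc d ≤_) (+-suc A 1) (≰⇒> many))) ⟩
          B + 2 + (A + 1)    ≡⟨ solve 2 (λ a b → b :+ con 2 :+ (a :+ con 1) := a :+ b :+ con 3) refl A B ⟩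
          A + B + 3          ≤⟨ +-monoˡ-≤ 3 (Longest.few-covering (covers-sound {c} e) longest) ⟩
          j + 3              ≤⟨ j+3≤2d ⟩
          d + d              ∎)
          where open ≤-Reasoning

      all-short : ∀ x y → adjᶜ x y ≡ true → π x < π y → π y < π x + s ⊎ π x + N < π y + s
      all-short x y e x<y with π x + s ≤? π y | π y + s ≤? π x + N
      ... | yes near  | yes far = ⊥-elim (long-edge x y e near far)
      ... | no  ¬near | _       = inj₁ (≰⇒> ¬near)
      ... | yes _     | no ¬far = inj₂ (≰⇒> ¬far)

      8s≤N : 8 * s ≤ N
      8s≤N = ≤-trans (m≤m+n (8 * s) 8) (≤-trans (≤-reflexive (sym m≡8s+8)) (m≤m*n m d))

      -- As all edges are short, the chord between two points g₁ and g₂ far apart is crossed only by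
      -- edges covering g₁ or g₂.
      module _ {g₁ g₂} (s<g₁ : s < g₁) (g₁<3s : g₁ < 3 * s) (5s<g₂ : 5 * s < g₂) (g₂<7s : g₂ < 7 * s)
               (few-at-g₁ : countPairs (covering g₁) + 2 ≤ d)
               (few-at-g₂ : countPairs (covering g₂) + 2 ≤ d) where

        private
          g₁<g₂ : g₁ < g₂
          g₁<g₂ = <-trans g₁<3s (≤-<-trans (*-monoˡ-≤ s {3} {5} (s≤s (s≤s (s≤s z≤n)))) 5s<g₂)

          g₂+s≤N : g₂ + s ≤ N
          g₂+s≤N = begin
            g₂ + s     ≤⟨ <⇒≤ (+-monoˡ-< s g₂<7s) ⟩
            7 * s + s  ≡⟨ solve 1 (λ s → con 7 :* s :+ s := con 8 :* s) refl s ⟩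
            8 * s      ≤⟨ 8s≤N ⟩
            N          ∎
            where open ≤-Reasoning

          g₂<N : g₂ < N
          g₂<N = <-≤-trans (m<m+n g₂ s>0) g₂+s≤N

        open Chord g₁<g₂ g₂<N

        leaves-at-g₂ : ∀ {x y} → π x < π y → π y < π x + s → adjᶜ x y ≡ true →
                       inner x ≡ true → outer y ≡ true → covers g₂ x y ≡ true
        leaves-at-g₂ x<y short e i o = covers-complete record
          { edge = e ; x<g = proj₂ (inner-sound i) ; g<y = [ y≮g₁ , id ] (outer-sound o) ; y<x+s = short }
          where y≮g₁ = λ y<g₁ → ⊥-elim (<-asym (<-trans (proj₁ (inner-sound i)) x<y) y<g₁)

        enters-at-g₁ : ∀ {x y} → π x < π y → π y < π x + s → adjᶜ x y ≡ true →
                       outer x ≡ true → inner y ≡ true → covers g₁ x y ≡ true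
        enters-at-g₁ x<y short e o i = covers-complete record
          { edge = e ; x<g = [ id , x≯g₂ ] (outer-sound o) ; g<y = proj₁ (inner-sound i) ; y<x+s = short }
          where x≯g₂ = λ g₂<x → ⊥-elim (<-asym (<-trans x<y (proj₂ (inner-sound i))) g₂<x)

        wrapping-not-across : ∀ {x y} → π x + N < π y + s → across x y ≡ true → ⊥
        wrapping-not-across {x} {y} wraps a =
          [ (λ io → <-asym (proj₁ (inner-sound (proj₁ io))) (<-trans x<s s<g₁))
          , (λ oi → <-asym (proj₂ (inner-sound (proj₂ oi))) g₂<y)
          ] (proj₂ (across-sound a))
          where
          x<s : π x < s
          x<s = +-cancelʳ-< N (π x) s
                  (<-≤-trans wraps (subst (_≤ s + N) (+-comm s (π y)) (+-monoʳ-≤ s (<⇒≤ (π<N y)))))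
          g₂<y : g₂ < π y
          g₂<y = +-cancelʳ-< s g₂ (π y) (≤-<-trans g₂+s≤N (≤-<-trans (m≤n+m N (π x)) wraps))

        across⇒covering-forward : ∀ x y → π x < π y → across x y ≡ true →
                                  covering g₁ x y ∨ covering g₂ x y ≡ true
        across⇒covering-forward x y x<y a =
          [ short-edge , (λ wraps → ⊥-elim (wrapping-not-across wraps a)) ] (all-short x y e x<y)
          where
          e = proj₁ (across-sound a)
          short-edge : π y < π x + s → covering g₁ x y ∨ covering g₂ x y ≡ true
          short-edge short =
            [ (λ io → ∨≡trueʳ (covering g₁ x y)
                        (cong (_∨ covers g₂ y x) (leaves-at-g₂ x<y short e (proj₁ io) (proj₂ io))))
            , (λ oi → cong (_∨ covering g₂ x y)
                        (cong (_∨ covers g₁ y x) (enters-at-g₁ x<y short e (proj₁ oi) (proj₂ oi))))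
            ] (proj₂ (across-sound a))

        across⇒covering : ∀ x y → across x y ≡ true → covering g₁ x y ∨ covering g₂ x y ≡ true
        across⇒covering x y a = by-order (<-cmp (π x) (π y))
          where
          by-order : Tri (π x < π y) (π x ≡ π y) (π y < π x) → covering g₁ x y ∨ covering g₂ x y ≡ true
          by-order (tri< x<y _ _) = across⇒covering-forward x y x<y a
          by-order (tri> _ _ y<x) =
            subst (_≡ true) (cong₂ _∨_ (∨-comm (covers g₁ y x) _) (∨-comm (covers g₂ y x) _))
                  (across⇒covering-forward y x y<x (trans (across-sym y x) a))
          by-order (tri≈ _ x≡y _) =
            ⊥-elim (not-¬ (across-separates x x (subst (λ w → across x w ≡ true) (sym (π-injective x≡y)) a))
                          (xor-same (inner x)))

        no-short-drawing : ⊥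
        no-short-drawing = chord-lemma few-across inside outside
          where
          open ≤-Reasoning
          A₁ = countPairs (covering g₁)
          A₂ = countPairs (covering g₂)
          cp≤ : countPairs across ≤ A₁ + A₂
          cp≤ = countPairs-∨ across⇒covering
          cp≤2d : countPairs across ≤ d + d
          cp≤2d = ≤-trans cp≤ (+-mono-≤ (m+n≤o⇒m≤o A₁ few-at-g₁) (m+n≤o⇒m≤o A₂ few-at-g₂))
          few-across : countPairs across + 3 ≤ d + d
          few-across = begin
            countPairs across + 3  ≤⟨ +-monoˡ-≤ 3 cp≤ ⟩
            A₁ + A₂ + 3            ≤⟨ n≤1+n _ ⟩
            suc (A₁ + A₂ + 3)      ≡⟨ solve 2 (λ a b → con 1 :+ (a :+ b :+ con 3) := (a :+ con 2) :+ (b :+ con 2))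
                                             refl A₁ A₂ ⟩
            (A₁ + 2) + (A₂ + 2)    ≤⟨ +-mono-≤ few-at-g₁ few-at-g₂ ⟩
            d + d                  ∎
          inside : T + countPairs across + suc g₁ ≤ g₂
          inside = begin
            T + countPairs across + suc g₁
              ≤⟨ +-mono-≤ (+-monoʳ-≤ T cp≤2d) g₁<3s ⟩
            T + (d + d) + 3 * s
              ≡⟨ cong (λ z → T + (d + z) + 3 * s) (+-identityʳ d) ⟨
            s + 3 * s
              ≡⟨ solve 1 (λ s → s :+ con 3 :* s := con 4 :* s) refl s ⟩
            4 * s
              ≤⟨ *-monoˡ-≤ s (n≤1+n 4) ⟩
            5 * s
              ≤⟨ <⇒≤ 5s<g₂ ⟩
            g₂ ∎
          outside : T + suc g₂ ≤ g₁ + N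
          outside = begin
            T + suc g₂  ≤⟨ +-mono-≤ (<⇒≤ T<s) g₂<7s ⟩
            s + 7 * s   ≡⟨ solve 1 (λ s → s :+ con 7 :* s := con 8 :* s) refl s ⟩
            8 * s       ≤⟨ 8s≤N ⟩
            N           ≤⟨ m≤n+m N g₁ ⟩
            g₁ + N      ∎

      no-drawing : ⊥
      no-drawing = from-cuts (cut-point (2 * s)) (cut-point (6 * s))
        where
        from-cuts : (∃ λ g → 2 * s < g + s × g < 2 * s + s × countPairs (covering g) + 2 ≤ d) →
                    (∃ λ g → 6 * s < g + s × g < 6 * s + s × countPairs (covering g) + 2 ≤ d) → ⊥
        from-cuts (g₁ , 2s<g₁+s , g₁<2s+s , few₁) (g₂ , 6s<g₂+s , g₂<6s+s , few₂) =
          no-short-drawing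
            (+-cancelʳ-< s s g₁ (subst (_< g₁ + s) (solve 1 (λ s → con 2 :* s := s :+ s) refl s) 2s<g₁+s))
            (subst (g₁ <_) (solve 1 (λ s → con 2 :* s :+ s := con 3 :* s) refl s) g₁<2s+s)
            (+-cancelʳ-< s (5 * s) g₂
               (subst (_< g₂ + s) (solve 1 (λ s → con 6 :* s := con 5 :* s :+ s) refl s) 6s<g₂+s))
            (subst (g₂ <_) (solve 1 (λ s → con 6 :* s :+ s := con 7 :* s) refl s) g₂<6s+s)
            few₁ few₂

  lcr°≡2d′ : ConvexLocalCrossingNumber G (2 * d′)
  lcr°≡2d′ = ((id , id) , identity-drawing) , no-better-drawing
    where
    j+3≤2d : ∀ {j} → j < 2 * d′ → j + 3 ≤ d + d
    j+3≤2d {j} j<2d′ = begin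
      j + 3       ≡⟨ +-comm j 3 ⟩
      3 + j       ≤⟨ s≤s (s≤s j<2d′) ⟩
      2 + 2 * d′  ≡⟨ solve 1 (λ e → con 2 :+ con 2 :* e := (con 1 :+ e) :+ (con 1 :+ e)) refl d′ ⟩
      d + d       ∎
      where open ≤-Reasoning
    no-better-drawing : ∀ j → j < 2 * d′ → ¬ Σ (ConvexDrawing G) λ D → OuterKPlanar G D j
    no-better-drawing j j<2d′ ((pos , pos-injective) , planar) =
      Drawing.no-drawing pos pos-injective j (j+3≤2d j<2d′) planar

  sn≡2d : SeparationNumber G (d + d)
  sn≡2d = balanced-separation , no-small-separation

theorem17 : (k : ℕ) → 2 ∣ k →
    Σ Graph λ G → ConvexLocalCrossingNumber G k × SeparationNumber G (k + 2)
theorem17 k (divides q k≡q*2) =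
  G , subst (ConvexLocalCrossingNumber G) (sym k≡2q) lcr°≡2d′ , subst (SeparationNumber G) (sym k+2≡2d) sn≡2d
  where
  open Cylinder q
  k≡2q : k ≡ 2 * q
  k≡2q = trans k≡q*2 (*-comm q 2)
  k+2≡2d : k + 2 ≡ d + d
  k+2≡2d = trans (cong (_+ 2) k≡2q) (solve 1 (λ q → con 2 :* q :+ con 2 := (con 1 :+ q) :+ (con 1 :+ q)) refl q)
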